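{- For $N>0$ and $|q|<1$, \begin{align*} \sigma(q,N):=\sum_{n=0}^{\infty}\genfrac{[}{]}{0pt}{}{N}{n}\frac{(q)_n q^{n(n+1)/2}}{(-q)_n}=\frac{(q)_{\infty}}{(-q^{N+1})_{\infty}}+2\sum_{n=1}^{\infty}\frac{q^n}{(1+q^n)}\frac{(q^{n+1})_\infty}{(-q^{N+n+1})_\infty}. \end{align*}
   Context: Here $(a)_n=(a;q)_n=\prod_{j=0}^{n-1}(1-aq^j)$, $(a)_\infty=\prod_{j\ge0}(1-aq^j)$, and $\genfrac{[}{]}{0pt}{}{N}{n}=\frac{(q)_N}{(q)_{N-n}(q)_n}$ is the $q$-binomial coefficient (equal to $0$ for $n>N$). The function $\sigma(q,N)$ is a finite analogue of Ramanujan's function $\sigma(q)=\sum_{n\ge0}q^{n(n+1)/2}/(-q;q)_n$. -}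

module Defs where

open import Data.Nat using (ℕ; zero; suc; _∸_; _≤?_) renaming (_+_ to _+ℕ_)
open import Data.Nat.Properties using (_≟_)
open import Data.Integer using (ℤ; +_; -_) renaming (_+_ to _+ℤ_; _*_ to _*ℤ_)
open import Data.Bool using (if_then_else_)
open import Relation.Nullary.Decidable using (⌊_⌋; yes; no)

-- Formal power series in q with integer coefficients: k ↦ coefficient of q^k.
PS : Set
PS = ℕ → ℤ

sumℤ : ℕ → (ℕ → ℤ) → ℤ
sumℤ zero    f = + 0
sumℤ (suc n) f = sumℤ n f +ℤ f n

constP : ℤ → PS
constP c zero    = c
constP c (suc k) = + 0

0ₚ 1ₚ : PS
0ₚ = constP (+ 0)
1ₚ = constP (+ 1)

X^ : ℕ → PS
X^ m k = if ⌊ k ≟ m ⌋ then + 1 else + 0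

q : PS
q = X^ 1

infixl 6 _+ₚ_ _-ₚ_
infixl 7 _*ₚ_ _/ₚ_

_+ₚ_ : PS → PS → PS
(a +ₚ b) k = a k +ℤ b k

negₚ : PS → PS
negₚ a k = - a k

_-ₚ_ : PS → PS → PS
a -ₚ b = a +ₚ negₚ b

_*ₚ_ : PS → PS → PS
(a *ₚ b) k = sumℤ (suc k) (λ i → a i *ℤ b (k ∸ i))

powₚ : PS → ℕ → PS
powₚ a zero    = 1ₚ
powₚ a (suc n) = powₚ a n *ₚ a

ΣP : ℕ → (ℕ → PS) → PS
ΣP n f k = sumℤ n (λ i → f i k)

ΠP : ℕ → (ℕ → PS) → PS
ΠP zero    f = 1ₚ
ΠP (suc n) f = ΠP n f *ₚ f n

-- Multiplicative inverse of a series with constant term 1: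
-- 1/a = Σ_{i≥0} (1-a)^i ; (1-a)^i has valuation ≥ i, so the
-- coefficient of q^k only involves i ≤ k.
invₚ : PS → PS
invₚ a k = ΣP (suc k) (λ i → powₚ (1ₚ -ₚ a) i) k

_/ₚ_ : PS → PS → PS
a /ₚ b = a *ₚ invₚ b

qpoch : PS → ℕ → PS
qpoch a n = ΠP n (λ j → 1ₚ -ₚ a *ₚ X^ j)

-- (a;q)_∞ for a with zero constant term: the factor 1 - a q^j differs
-- from 1 only in degrees ≥ j+1, so the coefficient of q^k equals that
-- of the finite product over j ≤ k.
qpochInf : PS → PS
qpochInf a k = qpoch a (suc k) k

qbinom : ℕ → ℕ → PS
qbinom N n with n ≤? N
... | yes _ = qpoch q N /ₚ (qpoch q (N ∸ n) *ₚ qpoch q n)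
... | no  _ = 0ₚ

-- infinite sums Σ_{n≥0} t n and Σ_{n≥1} t n, for families where t n has
-- q-adic valuation ≥ n (so the coefficient of q^k only involves n ≤ k)
sumFrom0 : (ℕ → PS) → PS
sumFrom0 t k = sumℤ (suc k) (λ n → t n k)

sumFrom1 : (ℕ → PS) → PS
sumFrom1 t k = sumℤ (suc k) (λ n → t (suc n) k)

tri : ℕ → ℕ
tri zero    = 0
tri (suc n) = tri n +ℕ suc n

σ : ℕ → PS
σ N = sumFrom0 (λ n → qbinom N n *ₚ qpoch q n *ₚ X^ (tri n) /ₚ qpoch (negₚ q) n)

module Submission where

-- Since (q)_n/(-q)_n = K (-q^{n+1})_∞/(q^{n+1})_∞ with K = (q)_∞/(-q)_∞,
-- the q-binomial theorem at a = -1, z = q^{n+1} turns the n-th summand into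
-- K [N n] q^{n(n+1)/2} Σ_m (-1)_m/(q)_m q^{m(n+1)}. Exchanging the two sums,
-- Cauchy's finite q-binomial theorem Σ_n [N n] q^{n(n+1)/2} z^n = (-zq)_N at
-- z = q^m gives σ(q,N) = K Σ_m (-1)_m/(q)_m q^m (-q^{m+1})_N. The m = 0 term is
-- (q)_∞/(-q^{N+1})_∞, and (-1)_m = 2 (-q)_{m-1} makes the term m ≥ 1 equal to
-- 2 q^m/(1+q^m) (q^{m+1})_∞/(-q^{N+m+1})_∞. (The argument does not use N > 0.)

open import Defs
open import Data.Nat as ℕ using (ℕ; zero; suc; _∸_; _≤_; _<_; z≤n; s≤s) renaming (_+_ to _+ℕ_; _*_ to _*ℕ_)
import Data.Nat.Properties as ℕP
import Data.Nat.Tactic.RingSolver as ℕSolver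
open import Data.Integer as ℤ using (ℤ; +_; -_) renaming (_+_ to _+ℤ_; _*_ to _*ℤ_)
import Data.Integer.Properties as ℤP
import Data.Integer.Tactic.RingSolver as ℤSolver
open import Data.Maybe.Base using (Maybe; just; nothing)
open import Data.Product using (_,_)
open import Data.Sum using (inj₁; inj₂)
open import Data.Empty using (⊥-elim)
open import Function using (_∘_)
open import Relation.Nullary using (yes; no)
open import Relation.Binary.PropositionalEquality
open import Algebra.Bundles using (CommutativeRing)
open import Algebra.Structures using (IsCommutativeRing)
import Algebra.Solver.Ring.AlmostCommutativeRing as ACR

sum-cong< : ∀ n {f g : ℕ → ℤ} → (∀ i → i < n → f i ≡ g i) → sumℤ n f ≡ sumℤ n g
sum-cong< zero    h = refl
sum-cong< (suc n) h = cong₂ _+ℤ_ (sum-cong< n (λ i p → h i (ℕP.m<n⇒m<1+n p))) (h n ℕP.≤-refl)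

sum-cong : ∀ n {f g : ℕ → ℤ} → (∀ i → f i ≡ g i) → sumℤ n f ≡ sumℤ n g
sum-cong n h = sum-cong< n (λ i _ → h i)

sum-+ : ∀ n (f g : ℕ → ℤ) → sumℤ n (λ i → f i +ℤ g i) ≡ sumℤ n f +ℤ sumℤ n g
sum-+ zero    f g = refl
sum-+ (suc n) f g =
  trans (cong (_+ℤ (f n +ℤ g n)) (sum-+ n f g)) (swap-middle (sumℤ n f) (sumℤ n g) (f n) (g n))
  where
  swap-middle : ∀ a b c d → (a +ℤ b) +ℤ (c +ℤ d) ≡ (a +ℤ c) +ℤ (b +ℤ d)
  swap-middle = ℤSolver.solve-∀

sum-*ˡ : ∀ n (c : ℤ) (f : ℕ → ℤ) → c *ℤ sumℤ n f ≡ sumℤ n (λ i → c *ℤ f i)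
sum-*ˡ zero    c f = ℤP.*-zeroʳ c
sum-*ˡ (suc n) c f = trans (ℤP.*-distribˡ-+ c (sumℤ n f) (f n)) (cong (_+ℤ (c *ℤ f n)) (sum-*ˡ n c f))

sum-*ʳ : ∀ n (c : ℤ) (f : ℕ → ℤ) → sumℤ n f *ℤ c ≡ sumℤ n (λ i → f i *ℤ c)
sum-*ʳ n c f = trans (ℤP.*-comm (sumℤ n f) c) (trans (sum-*ˡ n c f) (sum-cong n (λ i → ℤP.*-comm c (f i))))

sum-neg : ∀ n (f : ℕ → ℤ) → - sumℤ n f ≡ sumℤ n (λ i → - f i)
sum-neg zero    f = refl
sum-neg (suc n) f = trans (ℤP.neg-distrib-+ (sumℤ n f) (f n)) (cong (_+ℤ (- f n)) (sum-neg n f))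

sum-zero : ∀ n {f : ℕ → ℤ} → (∀ i → i < n → f i ≡ + 0) → sumℤ n f ≡ + 0
sum-zero n {f} h = trans (sum-cong< n h) (zeros n)
  where
  zeros : ∀ n → sumℤ n (λ _ → + 0) ≡ + 0
  zeros zero    = refl
  zeros (suc n) = cong (_+ℤ + 0) (zeros n)

sum-shift : ∀ n (f : ℕ → ℤ) → sumℤ (suc n) f ≡ f 0 +ℤ sumℤ n (f ∘ suc)
sum-shift zero    f = trans (ℤP.+-identityˡ (f 0)) (sym (ℤP.+-identityʳ (f 0)))
sum-shift (suc n) f =
  trans (cong (_+ℤ f (suc n)) (sum-shift n f)) (ℤP.+-assoc (f 0) (sumℤ n (f ∘ suc)) (f (suc n)))

sum-swap : ∀ n m (f : ℕ → ℕ → ℤ) →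
  sumℤ n (λ i → sumℤ m (λ j → f i j)) ≡ sumℤ m (λ j → sumℤ n (λ i → f i j))
sum-swap zero    m f = sym (sum-zero m (λ _ _ → refl))
sum-swap (suc n) m f = trans (cong (_+ℤ sumℤ m (f n)) (sum-swap n m f)) (sym (sum-+ m _ _))

sum-pad : ∀ n d (f : ℕ → ℤ) → (∀ i → n ≤ i → f i ≡ + 0) → sumℤ (n +ℕ d) f ≡ sumℤ n f
sum-pad n zero    f h = cong (λ x → sumℤ x f) (ℕP.+-identityʳ n)
sum-pad n (suc d) f h rewrite ℕP.+-suc n d =
  trans (cong₂ _+ℤ_ (sum-pad n d f h) (h (n +ℕ d) (ℕP.m≤m+n n d))) (ℤP.+-identityʳ _)

sum-pad≤ : ∀ n m (f : ℕ → ℤ) → n ≤ m → (∀ i → n ≤ i → f i ≡ + 0) → sumℤ m f ≡ sumℤ n f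
sum-pad≤ n m f n≤m h = trans (cong (λ x → sumℤ x f) (sym (ℕP.m+[n∸m]≡n n≤m))) (sum-pad n (m ∸ n) f h)

sum-reverse : ∀ n (g : ℕ → ℤ) → sumℤ n g ≡ sumℤ n (λ i → g (n ∸ suc i))
sum-reverse zero    g = refl
sum-reverse (suc n) g = trans (ℤP.+-comm (sumℤ n g) (g n))
  (trans (cong (g n +ℤ_) (sum-reverse n g)) (sym (sum-shift n (λ i → g (suc n ∸ suc i)))))

sum-triangle : ∀ n (F : ℕ → ℕ → ℤ) →
  sumℤ n (λ i → sumℤ (suc i) (F i)) ≡ sumℤ n (λ j → sumℤ (n ∸ j) (λ t → F (j +ℕ t) j))
sum-triangle zero    F = refl
sum-triangle (suc n) F = begin
    sumℤ n (λ i → sumℤ (suc i) (F i)) +ℤ sumℤ (suc n) (F n)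
  ≡⟨ cong (_+ℤ sumℤ (suc n) (F n)) (sum-triangle n F) ⟩
    sumℤ n (λ j → columnₙ j) +ℤ sumℤ (suc n) (F n)
  ≡⟨ cong (_+ℤ sumℤ (suc n) (F n)) (sym lastColumn) ⟩
    sumℤ (suc n) columnₙ +ℤ sumℤ (suc n) (F n)
  ≡⟨ sym (sum-+ (suc n) columnₙ (F n)) ⟩
    sumℤ (suc n) (λ j → columnₙ j +ℤ F n j)
  ≡⟨ sum-cong< (suc n) growColumn ⟩
    sumℤ (suc n) (λ j → sumℤ (suc n ∸ j) (λ t → F (j +ℕ t) j)) ∎
  where
  open ≡-Reasoning
  columnₙ : ℕ → ℤ
  columnₙ j = sumℤ (n ∸ j) (λ t → F (j +ℕ t) j)
  -- the column j = n of the old triangle is empty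
  lastColumn : sumℤ (suc n) columnₙ ≡ sumℤ n columnₙ
  lastColumn = trans (cong (λ x → sumℤ n columnₙ +ℤ sumℤ x (λ t → F (n +ℕ t) n)) (ℕP.n∸n≡0 n))
                     (ℤP.+-identityʳ _)
  growColumn : ∀ j → j < suc n → columnₙ j +ℤ F n j ≡ sumℤ (suc n ∸ j) (λ t → F (j +ℕ t) j)
  growColumn j (s≤s j≤n) = sym (trans (cong (λ x → sumℤ x (λ t → F (j +ℕ t) j)) (ℕP.+-∸-assoc 1 j≤n))
    (cong (λ x → columnₙ j +ℤ F x j) (ℕP.m+[n∸m]≡n j≤n)))

infix 4 _≈_
record _≈_ (a b : PS) : Set where
  constructor mk≈
  field at : ∀ k → a k ≡ b k
open _≈_

≈-refl : ∀ {a} → a ≈ a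
≈-refl = mk≈ λ k → refl

≈-sym : ∀ {a b} → a ≈ b → b ≈ a
≈-sym p = mk≈ λ k → sym (at p k)

≈-trans : ∀ {a b c} → a ≈ b → b ≈ c → a ≈ c
≈-trans p r = mk≈ λ k → trans (at p k) (at r k)

≡⇒≈ : ∀ {a b} → a ≡ b → a ≈ b
≡⇒≈ refl = ≈-refl

+-cong : ∀ {a a′ b b′} → a ≈ a′ → b ≈ b′ → a +ₚ b ≈ a′ +ₚ b′
+-cong p r = mk≈ λ k → cong₂ _+ℤ_ (at p k) (at r k)

neg-cong : ∀ {a a′} → a ≈ a′ → negₚ a ≈ negₚ a′
neg-cong p = mk≈ λ k → cong -_ (at p k)

*-cong : ∀ {a a′ b b′} → a ≈ a′ → b ≈ b′ → a *ₚ b ≈ a′ *ₚ b′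
*-cong p r = mk≈ λ k → sum-cong (suc k) (λ i → cong₂ _*ℤ_ (at p i) (at r (k ∸ i)))

0ₚ-coeff : ∀ k → 0ₚ k ≡ + 0
0ₚ-coeff zero    = refl
0ₚ-coeff (suc k) = refl

+-comm : ∀ a b → a +ₚ b ≈ b +ₚ a
+-comm a b = mk≈ λ k → ℤP.+-comm (a k) (b k)

+-assoc : ∀ a b c → (a +ₚ b) +ₚ c ≈ a +ₚ (b +ₚ c)
+-assoc a b c = mk≈ λ k → ℤP.+-assoc (a k) (b k) (c k)

+-identityˡ : ∀ a → 0ₚ +ₚ a ≈ a
+-identityˡ a = mk≈ λ k → trans (cong (_+ℤ a k) (0ₚ-coeff k)) (ℤP.+-identityˡ (a k))

+-identityʳ : ∀ a → a +ₚ 0ₚ ≈ a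
+-identityʳ a = mk≈ λ k → trans (cong (a k +ℤ_) (0ₚ-coeff k)) (ℤP.+-identityʳ (a k))

+-inverseˡ : ∀ a → negₚ a +ₚ a ≈ 0ₚ
+-inverseˡ a = mk≈ λ k → trans (ℤP.+-inverseˡ (a k)) (sym (0ₚ-coeff k))

+-inverseʳ : ∀ a → a +ₚ negₚ a ≈ 0ₚ
+-inverseʳ a = mk≈ λ k → trans (ℤP.+-inverseʳ (a k)) (sym (0ₚ-coeff k))

-- Commutativity of the Cauchy product: reverse the convolution sum.
*-comm : ∀ a b → a *ₚ b ≈ b *ₚ a
*-comm a b = mk≈ λ k → trans (sum-reverse (suc k) (λ i → a i *ℤ b (k ∸ i)))
  (sum-cong< (suc k) (λ i i≤k → trans (ℤP.*-comm (a (k ∸ i)) _)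
    (cong (λ x → b x *ℤ a (k ∸ i)) (ℕP.m∸[m∸n]≡n (ℕP.≤-pred i≤k)))))

-- Associativity of the Cauchy product: both sides are the sum of
-- a j b t c (k-j-t) over j + t ≤ k, exchanged by sum-triangle.
*-assoc : ∀ a b c → (a *ₚ b) *ₚ c ≈ a *ₚ (b *ₚ c)
*-assoc a b c = mk≈ λ k → begin
    sumℤ (suc k) (λ i → sumℤ (suc i) (λ j → a j *ℤ b (i ∸ j)) *ℤ c (k ∸ i))
  ≡⟨ sum-cong (suc k) (λ i → sum-*ʳ (suc i) (c (k ∸ i)) _) ⟩
    sumℤ (suc k) (λ i → sumℤ (suc i) (λ j → a j *ℤ b (i ∸ j) *ℤ c (k ∸ i)))
  ≡⟨ sum-triangle (suc k) (λ i j → a j *ℤ b (i ∸ j) *ℤ c (k ∸ i)) ⟩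
    sumℤ (suc k) (λ j → sumℤ (suc k ∸ j) (λ t → a j *ℤ b (j +ℕ t ∸ j) *ℤ c (k ∸ (j +ℕ t))))
  ≡⟨ sum-cong< (suc k) (row k) ⟩
    sumℤ (suc k) (λ j → a j *ℤ sumℤ (suc (k ∸ j)) (λ t → b t *ℤ c (k ∸ j ∸ t))) ∎
  where
  open ≡-Reasoning
  row : ∀ k j → j < suc k →
    sumℤ (suc k ∸ j) (λ t → a j *ℤ b (j +ℕ t ∸ j) *ℤ c (k ∸ (j +ℕ t)))
      ≡ a j *ℤ sumℤ (suc (k ∸ j)) (λ t → b t *ℤ c (k ∸ j ∸ t))
  row k j (s≤s j≤k) = begin
      sumℤ (suc k ∸ j) (λ t → a j *ℤ b (j +ℕ t ∸ j) *ℤ c (k ∸ (j +ℕ t)))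
    ≡⟨ cong (λ x → sumℤ x (λ t → a j *ℤ b (j +ℕ t ∸ j) *ℤ c (k ∸ (j +ℕ t)))) (ℕP.+-∸-assoc 1 j≤k) ⟩
      sumℤ (suc (k ∸ j)) (λ t → a j *ℤ b (j +ℕ t ∸ j) *ℤ c (k ∸ (j +ℕ t)))
    ≡⟨ sum-cong (suc (k ∸ j)) (λ t → trans
         (cong₂ (λ x y → a j *ℤ b x *ℤ c y) (ℕP.m+n∸m≡n j t) (sym (ℕP.∸-+-assoc k j t)))
         (ℤP.*-assoc (a j) (b t) (c (k ∸ j ∸ t)))) ⟩
      sumℤ (suc (k ∸ j)) (λ t → a j *ℤ (b t *ℤ c (k ∸ j ∸ t)))
    ≡⟨ sym (sum-*ˡ (suc (k ∸ j)) (a j) _) ⟩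
      a j *ℤ sumℤ (suc (k ∸ j)) (λ t → b t *ℤ c (k ∸ j ∸ t)) ∎

*-distribˡ-+ : ∀ a b c → a *ₚ (b +ₚ c) ≈ (a *ₚ b) +ₚ (a *ₚ c)
*-distribˡ-+ a b c = mk≈ λ k →
  trans (sum-cong (suc k) (λ i → ℤP.*-distribˡ-+ (a i) (b (k ∸ i)) (c (k ∸ i)))) (sum-+ (suc k) _ _)

*-distribʳ-+ : ∀ a b c → (b +ₚ c) *ₚ a ≈ (b *ₚ a) +ₚ (c *ₚ a)
*-distribʳ-+ a b c = ≈-trans (*-comm (b +ₚ c) a)
  (≈-trans (*-distribˡ-+ a b c) (+-cong (*-comm a b) (*-comm a c)))

*-identityˡ : ∀ a → 1ₚ *ₚ a ≈ a
*-identityˡ a = mk≈ λ k → trans (sum-shift k (λ i → 1ₚ i *ℤ a (k ∸ i)))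
  (trans (cong (+ 1 *ℤ a k +ℤ_) (sum-zero k (λ i _ → refl)))
         (trans (ℤP.+-identityʳ _) (ℤP.*-identityˡ (a k))))

*-identityʳ : ∀ a → a *ₚ 1ₚ ≈ a
*-identityʳ a = ≈-trans (*-comm a 1ₚ) (*-identityˡ a)

*-zeroˡ : ∀ a → 0ₚ *ₚ a ≈ 0ₚ
*-zeroˡ a = mk≈ λ k → trans (sum-zero (suc k) (λ i _ → cong (_*ℤ a (k ∸ i)) (0ₚ-coeff i))) (sym (0ₚ-coeff k))

*-zeroʳ : ∀ a → a *ₚ 0ₚ ≈ 0ₚ
*-zeroʳ a = ≈-trans (*-comm a 0ₚ) (*-zeroˡ a)

PS-isCommutativeRing : IsCommutativeRing _≈_ _+ₚ_ _*ₚ_ negₚ 0ₚ 1ₚ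
PS-isCommutativeRing = record
  { isRing = record
    { +-isAbelianGroup = record
      { isGroup = record
        { isMonoid = record
          { isSemigroup = record
            { isMagma = record
              { isEquivalence = record { refl = ≈-refl ; sym = ≈-sym ; trans = ≈-trans }
              ; ∙-cong = +-cong }
            ; assoc = +-assoc }
          ; identity = +-identityˡ , +-identityʳ }
        ; inverse = +-inverseˡ , +-inverseʳ
        ; ⁻¹-cong = neg-cong }
      ; comm = +-comm }
    ; *-cong = *-cong
    ; *-assoc = *-assoc
    ; *-identity = *-identityˡ , *-identityʳ
    ; distrib = *-distribˡ-+ , *-distribʳ-+ }
  ; *-comm = *-comm }

PS-ring : CommutativeRing _ _
PS-ring = record { isCommutativeRing = PS-isCommutativeRing }

constP-homomorphism : ℤ.+-*-rawRing ACR.-Raw-AlmostCommutative⟶ ACR.fromCommutativeRing PS-ring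
constP-homomorphism = record
  { ⟦_⟧    = constP
  ; +-homo = λ a b → mk≈ λ { zero → refl ; (suc k) → refl }
  ; *-homo = λ a b → mk≈ λ
      { zero    → sym (ℤP.+-identityˡ (a *ℤ b))
      ; (suc k) → sym (sum-zero (suc (suc k)) (λ { zero _ → ℤP.*-zeroʳ a ; (suc i) _ → refl })) }
  ; -‿homo = λ a → mk≈ λ { zero → refl ; (suc k) → refl }
  ; 0-homo = ≈-refl
  ; 1-homo = ≈-refl }

constP-≟ : ∀ a b → Maybe (constP a ≈ constP b)
constP-≟ a b with a ℤ.≟ b
... | yes refl = just ≈-refl
... | no  _    = nothing

open import Algebra.Solver.Ring ℤ.+-*-rawRing (ACR.fromCommutativeRing PS-ring) constP-homomorphism constP-≟
  using (solve; con; _:+_; _:*_; _:-_; :-_; _:=_)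
open import Algebra.Properties.CommutativeSemigroup (CommutativeRing.*-commutativeSemigroup PS-ring)
  using (interchange)
open import Relation.Binary.Reasoning.Setoid (CommutativeRing.setoid PS-ring)

X^-coeff-self : ∀ m → X^ m m ≡ + 1
X^-coeff-self m with m ℕP.≟ m
... | yes _  = refl
... | no m≢m = ⊥-elim (m≢m refl)

X^-coeff-other : ∀ m k → k ≢ m → X^ m k ≡ + 0
X^-coeff-other m k k≢m with k ℕP.≟ m
... | yes k≡m = ⊥-elim (k≢m k≡m)
... | no  _   = refl

sum-X^-below : ∀ n m (g : ℕ → ℤ) → n ≤ m → sumℤ n (λ i → X^ m i *ℤ g i) ≡ + 0
sum-X^-below n m g n≤m = sum-zero n (λ i i<n →
  cong (_*ℤ g i) (X^-coeff-other m i (λ i≡m → ℕP.<-irrefl i≡m (ℕP.<-≤-trans i<n n≤m))))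

sum-X^-picks : ∀ n m (g : ℕ → ℤ) → m < n → sumℤ n (λ i → X^ m i *ℤ g i) ≡ g m
sum-X^-picks (suc n) m g (s≤s m≤n) with ℕP.m≤n⇒m<n∨m≡n m≤n
... | inj₁ m<n = trans (cong₂ _+ℤ_ (sum-X^-picks n m g m<n)
                                   (cong (_*ℤ g n) (X^-coeff-other m n (λ n≡m → ℕP.<-irrefl (sym n≡m) m<n))))
                       (ℤP.+-identityʳ (g m))
... | inj₂ refl = trans (cong₂ _+ℤ_ (sum-X^-below m m g ℕP.≤-refl)
                                    (trans (cong (_*ℤ g m) (X^-coeff-self m)) (ℤP.*-identityˡ (g m))))
                        (ℤP.+-identityˡ (g m))

X^*-coeff-≥ : ∀ m a k → m ≤ k → (X^ m *ₚ a) k ≡ a (k ∸ m)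
X^*-coeff-≥ m a k m≤k = sum-X^-picks (suc k) m (λ i → a (k ∸ i)) (s≤s m≤k)

X^*-coeff-< : ∀ m a k → k < m → (X^ m *ₚ a) k ≡ + 0
X^*-coeff-< m a k k<m = sum-X^-below (suc k) m (λ i → a (k ∸ i)) k<m

X^-+ : ∀ m n → X^ m *ₚ X^ n ≈ X^ (m +ℕ n)
X^-+ m n = mk≈ coeff
  where
  coeff : ∀ k → (X^ m *ₚ X^ n) k ≡ X^ (m +ℕ n) k
  coeff k with m ℕ.≤? k
  ... | no m≰k = trans (X^*-coeff-< m (X^ n) k (ℕP.≰⇒> m≰k))
    (sym (X^-coeff-other (m +ℕ n) k (λ k≡m+n → m≰k (subst (m ≤_) (sym k≡m+n) (ℕP.m≤m+n m n)))))
  ... | yes m≤k with k ℕP.≟ m +ℕ n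
  ...   | yes refl = trans (X^*-coeff-≥ m (X^ n) k m≤k)
                           (trans (cong (X^ n) (ℕP.m+n∸m≡n m n)) (X^-coeff-self n))
  ...   | no k≢m+n = trans (X^*-coeff-≥ m (X^ n) k m≤k)
    (X^-coeff-other n (k ∸ m) (λ k-m≡n → k≢m+n (trans (sym (ℕP.m+[n∸m]≡n m≤k)) (cong (m +ℕ_) k-m≡n))))

X^-zero : X^ 0 ≈ 1ₚ
X^-zero = mk≈ λ { zero → refl ; (suc k) → refl }

X^-suc : ∀ m → X^ m *ₚ q ≈ X^ (suc m)
X^-suc m = subst (λ k → X^ m *ₚ q ≈ X^ k) (ℕP.+-comm m 1) (X^-+ m 1)

-- q-adic valuation: val≥ a m says that q^m divides a.

val≥ : PS → ℕ → Set
val≥ a m = ∀ i → i < m → a i ≡ + 0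

val-mono : ∀ {a m n} → n ≤ m → val≥ a m → val≥ a n
val-mono n≤m v i i<n = v i (ℕP.<-≤-trans i<n n≤m)

val-cong : ∀ {a b m} → a ≈ b → val≥ a m → val≥ b m
val-cong p v i i<m = trans (sym (at p i)) (v i i<m)

val-X^ : ∀ m → val≥ (X^ m) m
val-X^ m i i<m = X^-coeff-other m i (λ i≡m → ℕP.<-irrefl i≡m i<m)

val-neg : ∀ {a m} → val≥ a m → val≥ (negₚ a) m
val-neg va i i<m = cong -_ (va i i<m)

val-* : ∀ {a b m n} → val≥ a m → val≥ b n → val≥ (a *ₚ b) (m +ℕ n)
val-* {a} {b} {m} {n} va vb k k<m+n = sum-zero (suc k) term
  where
  term : ∀ i → i < suc k → a i *ℤ b (k ∸ i) ≡ + 0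
  term i (s≤s i≤k) with i ℕ.<? m
  ... | yes i<m = cong (_*ℤ b (k ∸ i)) (va i i<m)
  ... | no  i≮m = trans (cong (a i *ℤ_) (vb (k ∸ i) k-i<n)) (ℤP.*-zeroʳ (a i))
    where
    k-i<n : k ∸ i < n
    k-i<n = ℕP.+-cancelˡ-< i (k ∸ i) n (subst (_< i +ℕ n) (sym (ℕP.m+[n∸m]≡n i≤k))
              (ℕP.<-≤-trans k<m+n (ℕP.+-monoˡ-≤ n (ℕP.≮⇒≥ i≮m))))

val-*ˡ : ∀ {a b n} → val≥ b n → val≥ (a *ₚ b) n
val-*ˡ {a} {b} {n} vb = val-* {a} {b} {0} {n} (λ i ()) vb

val-*ʳ : ∀ {a b n} → val≥ a n → val≥ (a *ₚ b) n
val-*ʳ {a} {b} {n} va = val-mono (ℕP.m≤m+n n 0) (val-* {a} {b} {n} {0} va (λ i ()))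

-- Agreement modulo q^K: a ≡[ K ] b compares the coefficients below K.
-- Two series are equal as soon as they agree modulo every q^K.

_≡[_]_ : PS → ℕ → PS → Set
a ≡[ K ] b = ∀ i → i < K → a i ≡ b i

≡[]-refl : ∀ {a K} → a ≡[ K ] a
≡[]-refl i _ = refl

≈⇒≡[] : ∀ {a b K} → a ≈ b → a ≡[ K ] b
≈⇒≡[] p i _ = at p i

≡[]-sym : ∀ {a b K} → a ≡[ K ] b → b ≡[ K ] a
≡[]-sym p i h = sym (p i h)

≡[]-trans : ∀ {a b c K} → a ≡[ K ] b → b ≡[ K ] c → a ≡[ K ] c
≡[]-trans p r i h = trans (p i h) (r i h)

≡[]-mono : ∀ {a b K L} → L ≤ K → a ≡[ K ] b → a ≡[ L ] b
≡[]-mono L≤K p i h = p i (ℕP.<-≤-trans h L≤K)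

≡[]-+ : ∀ {a a′ b b′ K} → a ≡[ K ] a′ → b ≡[ K ] b′ → (a +ₚ b) ≡[ K ] (a′ +ₚ b′)
≡[]-+ p r i h = cong₂ _+ℤ_ (p i h) (r i h)

≡[]-neg : ∀ {a a′ K} → a ≡[ K ] a′ → negₚ a ≡[ K ] negₚ a′
≡[]-neg p i h = cong -_ (p i h)

≡[]-* : ∀ {a a′ b b′ K} → a ≡[ K ] a′ → b ≡[ K ] b′ → (a *ₚ b) ≡[ K ] (a′ *ₚ b′)
≡[]-* {K = K} p r k k<K = sum-cong< (suc k) (λ i i≤k →
  cong₂ _*ℤ_ (p i (ℕP.≤-<-trans (ℕP.≤-pred i≤k) k<K)) (r (k ∸ i) (ℕP.≤-<-trans (ℕP.m∸n≤m k i) k<K)))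

≡[]-*1 : ∀ {a b K} → b ≡[ K ] 1ₚ → (a *ₚ b) ≡[ K ] a
≡[]-*1 {a} p = ≡[]-trans (≡[]-* (≡[]-refl {a}) p) (≈⇒≡[] (*-identityʳ a))

val⇒≡[]0 : ∀ {a K} → val≥ a K → a ≡[ K ] 0ₚ
val⇒≡[]0 v i h = trans (v i h) (sym (0ₚ-coeff i))

≡[]0⇒val : ∀ {a K} → a ≡[ K ] 0ₚ → val≥ a K
≡[]0⇒val p i h = trans (p i h) (0ₚ-coeff i)

≡[]-all : ∀ {a b} → (∀ K → a ≡[ K ] b) → a ≈ b
≡[]-all p = mk≈ λ k → p (suc k) k ℕP.≤-refl

-- Units: series with constant term 1. The inverse invₚ a is the geometric
-- series Σ (1-a)^i, truncated where (1-a)^i has valuation beyond the degree.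

unit : PS → Set
unit a = a 0 ≡ + 1

unit-* : ∀ {a b} → unit a → unit b → unit (a *ₚ b)
unit-* {a} {b} ua ub = trans (ℤP.+-identityˡ _) (cong₂ _*ℤ_ ua ub)

unit-1- : ∀ {c} → c 0 ≡ + 0 → unit (1ₚ -ₚ c)
unit-1- h = cong (λ x → + 1 +ℤ - x) h

pow-cong : ∀ {a b} → a ≈ b → ∀ i → powₚ a i ≈ powₚ b i
pow-cong p zero    = ≈-refl
pow-cong p (suc i) = *-cong (pow-cong p i) p

-- If q divides e then q^i divides e^i; this makes the geometric series summable.
pow-val : ∀ {e} → val≥ e 1 → ∀ i → val≥ (powₚ e i) i
pow-val v zero    = λ i ()
pow-val {e} v (suc i) =
  subst (val≥ (powₚ e (suc i))) (ℕP.+-comm i 1) (val-* {powₚ e i} {e} {i} {1} (pow-val v i) v)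

ΣP-cong : ∀ n {f g} → (∀ i → f i ≈ g i) → ΣP n f ≈ ΣP n g
ΣP-cong n p = mk≈ λ k → sum-cong n (λ i → at (p i) k)

geometric : ∀ a K → a *ₚ ΣP K (powₚ (1ₚ -ₚ a)) ≈ 1ₚ -ₚ powₚ (1ₚ -ₚ a) K
geometric a zero = begin
    a *ₚ ΣP 0 (powₚ (1ₚ -ₚ a)) ≈⟨ *-cong (≈-refl {a}) (mk≈ λ k → sym (0ₚ-coeff k)) ⟩
    a *ₚ 0ₚ                    ≈⟨ solve 1 (λ a → a :* con (+ 0) := con (+ 1) :- con (+ 1)) ≈-refl a ⟩
    1ₚ -ₚ 1ₚ                   ∎
geometric a (suc K) = begin
    a *ₚ (S +ₚ p)       ≈⟨ *-distribˡ-+ a S p ⟩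
    a *ₚ S +ₚ a *ₚ p    ≈⟨ +-cong (geometric a K) (≈-refl {a *ₚ p}) ⟩
    (1ₚ -ₚ p) +ₚ a *ₚ p ≈⟨ solve 2 (λ a p → (con (+ 1) :- p) :+ a :* p := con (+ 1) :- p :* (con (+ 1) :- a)) ≈-refl a p ⟩
    1ₚ -ₚ powₚ (1ₚ -ₚ a) (suc K) ∎
  where
  S = ΣP K (powₚ (1ₚ -ₚ a))
  p = powₚ (1ₚ -ₚ a) K

unit⇒val-1- : ∀ {a} → unit a → val≥ (1ₚ -ₚ a) 1
unit⇒val-1- u zero    _           = cong (λ x → + 1 +ℤ - x) u
unit⇒val-1- u (suc i) (s≤s ())

inv-≡[] : ∀ {a} → unit a → ∀ K → invₚ a ≡[ K ] ΣP K (powₚ (1ₚ -ₚ a))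
inv-≡[] {a} u K i i<K = sym (sum-pad≤ (suc i) K (λ j → powₚ (1ₚ -ₚ a) j i) i<K
  (λ j i<j → pow-val (unit⇒val-1- u) j i i<j))

-- Modulo q^K the inverse is the geometric sum, and a times it is 1 - (1-a)^K ≡ 1.
inverseʳ : ∀ {a} → unit a → a *ₚ invₚ a ≈ 1ₚ
inverseʳ {a} u = ≡[]-all λ K →
  ≡[]-trans (≡[]-* (≡[]-refl {a}) (inv-≡[] u K))
  (≡[]-trans (≈⇒≡[] (geometric a K))
             (λ i i<K → trans (cong (λ x → 1ₚ i +ℤ - x) (pow-val (unit⇒val-1- u) K i i<K)) (ℤP.+-identityʳ _)))

inverseˡ : ∀ {a} → unit a → invₚ a *ₚ a ≈ 1ₚ
inverseˡ {a} u = ≈-trans (*-comm (invₚ a) a) (inverseʳ {a} u)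

inv-cong : ∀ {a b} → a ≈ b → invₚ a ≈ invₚ b
inv-cong p = mk≈ λ k → sum-cong (suc k) (λ i → at (pow-cong (+-cong (≈-refl {1ₚ}) (neg-cong p)) i) k)

div-cong : ∀ {a a′ b b′} → a ≈ a′ → b ≈ b′ → a /ₚ b ≈ a′ /ₚ b′
div-cong p r = *-cong p (inv-cong r)

div-* : ∀ {a b} → unit b → (a /ₚ b) *ₚ b ≈ a
div-* {a} {b} u = begin
  (a *ₚ invₚ b) *ₚ b ≈⟨ *-assoc a (invₚ b) b ⟩
  a *ₚ (invₚ b *ₚ b) ≈⟨ *-cong (≈-refl {a}) (inverseˡ {b} u) ⟩
  a *ₚ 1ₚ            ≈⟨ *-identityʳ a ⟩
  a                  ∎

div-unique : ∀ {a b c} → unit b → c *ₚ b ≈ a → c ≈ a /ₚ b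
div-unique {a} {b} {c} u p = begin
  c                  ≈⟨ *-identityʳ c ⟨
  c *ₚ 1ₚ            ≈⟨ *-cong (≈-refl {c}) (inverseʳ {b} u) ⟨
  c *ₚ (b *ₚ invₚ b) ≈⟨ *-assoc c b (invₚ b) ⟨
  (c *ₚ b) *ₚ invₚ b ≈⟨ *-cong p (≈-refl {invₚ b}) ⟩
  a *ₚ invₚ b        ∎

*-cancelʳ : ∀ {x y b} → unit b → x *ₚ b ≈ y *ₚ b → x ≈ y
*-cancelʳ {x} {y} {b} u p = ≈-trans (div-unique {x *ₚ b} {b} {x} u ≈-refl) (≈-sym (div-unique {x *ₚ b} {b} {y} u (≈-sym p)))

factor : PS → ℕ → PS
factor a j = 1ₚ -ₚ a *ₚ X^ j

factor-neg : ∀ a m → factor (negₚ a) m ≈ 1ₚ +ₚ a *ₚ X^ m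
factor-neg a m = ≈-trans (+-cong (≈-refl {1ₚ}) (neg-cong (solve 2 (λ a x → (:- a) :* x := :- (a :* x)) ≈-refl a (X^ m))))
  (solve 1 (λ y → con (+ 1) :- (:- y) := con (+ 1) :+ y) ≈-refl (a *ₚ X^ m))

ΠP-cong : ∀ n {f g} → (∀ i → f i ≈ g i) → ΠP n f ≈ ΠP n g
ΠP-cong zero    p = ≈-refl
ΠP-cong (suc n) p = *-cong (ΠP-cong n p) (p n)

qpoch-cong : ∀ {a b} → a ≈ b → ∀ n → qpoch a n ≈ qpoch b n
qpoch-cong p n = ΠP-cong n (λ j → +-cong (≈-refl {1ₚ}) (neg-cong (*-cong p (≈-refl {X^ j}))))

qpochInf-cong : ∀ {a b} → a ≈ b → qpochInf a ≈ qpochInf b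
qpochInf-cong p = mk≈ λ k → at (qpoch-cong p (suc k)) k

qpoch-shift : ∀ a n → qpoch a (suc n) ≈ (1ₚ -ₚ a) *ₚ qpoch (a *ₚ q) n
qpoch-shift a zero = begin
  1ₚ *ₚ factor a 0 ≈⟨ *-cong (≈-refl {1ₚ}) (+-cong (≈-refl {1ₚ}) (neg-cong (≈-trans (*-cong (≈-refl {a}) X^-zero) (*-identityʳ a)))) ⟩
  1ₚ *ₚ (1ₚ -ₚ a)  ≈⟨ *-comm 1ₚ (1ₚ -ₚ a) ⟩
  (1ₚ -ₚ a) *ₚ 1ₚ  ∎
qpoch-shift a (suc n) = begin
  qpoch a (suc n) *ₚ factor a (suc n)
    ≈⟨ *-cong (qpoch-shift a n) (+-cong (≈-refl {1ₚ}) (neg-cong aq^n)) ⟩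
  ((1ₚ -ₚ a) *ₚ qpoch (a *ₚ q) n) *ₚ factor (a *ₚ q) n
    ≈⟨ *-assoc (1ₚ -ₚ a) (qpoch (a *ₚ q) n) (factor (a *ₚ q) n) ⟩
  (1ₚ -ₚ a) *ₚ qpoch (a *ₚ q) (suc n) ∎
  where
  aq^n : a *ₚ X^ (suc n) ≈ (a *ₚ q) *ₚ X^ n
  aq^n = ≈-trans (*-cong (≈-refl {a}) (≈-sym (X^-+ 1 n))) (≈-sym (*-assoc a q (X^ n)))

-- The infinite product (a;q)_∞ is meaningful for a without constant term.
ConstFree : PS → Set
ConstFree a = val≥ a 1

constFree-X^ : ∀ m → ConstFree (X^ (suc m))
constFree-X^ m = val-mono (s≤s z≤n) (val-X^ (suc m))

factor-val : ∀ {a} → ConstFree a → ∀ j → val≥ (a *ₚ X^ j) (suc j)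
factor-val {a} z j = val-* {a} {X^ j} {1} {j} z (val-X^ j)

factor-≡[]1 : ∀ {a K} j → val≥ (a *ₚ X^ j) K → factor a j ≡[ K ] 1ₚ
factor-≡[]1 j v i h = trans (cong (λ x → 1ₚ i +ℤ - x) (v i h)) (ℤP.+-identityʳ _)

unit-factor : ∀ {a} → ConstFree a → ∀ j → unit (factor a j)
unit-factor {a} z j = unit-1- {a *ₚ X^ j} (factor-val z j 0 (s≤s z≤n))

unit-qpoch : ∀ {a} → ConstFree a → ∀ n → unit (qpoch a n)
unit-qpoch z zero    = refl
unit-qpoch {a} z (suc n) = unit-* {qpoch a n} {factor a n} (unit-qpoch z n) (unit-factor z n)

unit-qpochInf : ∀ {a} → ConstFree a → unit (qpochInf a)
unit-qpochInf z = unit-qpoch z 1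

-- Modulo q^{n+1} the factors beyond the n-th are 1, so the finite products
-- stabilise and (a;q)_∞ agrees with (a;q)_K modulo q^K.
qpoch-stable-step : ∀ {a} → ConstFree a → ∀ n → qpoch a n ≡[ suc n ] qpoch a (suc n)
qpoch-stable-step {a} z n = ≡[]-sym (≡[]-*1 {qpoch a n} {factor a n} (factor-≡[]1 {a} n (factor-val {a} z n)))

qpoch-stable : ∀ {a} → ConstFree a → ∀ n d → qpoch a n ≡[ suc n ] qpoch a (n +ℕ d)
qpoch-stable {a} z n zero = subst (λ m → qpoch a n ≡[ suc n ] qpoch a m) (sym (ℕP.+-identityʳ n)) ≡[]-refl
qpoch-stable {a} z n (suc d) = subst (λ m → qpoch a n ≡[ suc n ] qpoch a m) (sym (ℕP.+-suc n d))
  (≡[]-trans (qpoch-stable z n d) (≡[]-mono (s≤s (ℕP.m≤m+n n d)) (qpoch-stable-step z (n +ℕ d))))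

qpochInf-≡[] : ∀ {a} → ConstFree a → ∀ K → qpochInf a ≡[ K ] qpoch a K
qpochInf-≡[] {a} z K i i<K = subst (λ m → qpoch a (suc i) i ≡ qpoch a m i) (ℕP.m+[n∸m]≡n i<K)
  (qpoch-stable z (suc i) (K ∸ suc i) i (ℕP.m<n⇒m<1+n (ℕP.n<1+n i)))

qpochInf-shift : ∀ {a} → ConstFree a → qpochInf a ≈ (1ₚ -ₚ a) *ₚ qpochInf (a *ₚ q)
qpochInf-shift {a} z = ≡[]-all λ K →
  ≡[]-trans (qpochInf-≡[] z K)
  (≡[]-trans (≡[]-mono (ℕP.n≤1+n K) (qpoch-stable-step z K))
  (≡[]-trans (≈⇒≡[] (qpoch-shift a K))
  (≡[]-* (≡[]-refl {1ₚ -ₚ a}) (≡[]-sym (qpochInf-≡[] (val-*ʳ {a} {q} z) K)))))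

qpoch-split : ∀ {a} → ConstFree a → ∀ n → qpoch a n *ₚ qpochInf (a *ₚ X^ n) ≈ qpochInf a
qpoch-split {a} z zero = ≈-trans (*-identityˡ _) (qpochInf-cong (≈-trans (*-cong (≈-refl {a}) X^-zero) (*-identityʳ a)))
qpoch-split {a} z (suc n) = begin
  (qpoch a n *ₚ factor a n) *ₚ qpochInf (a *ₚ X^ (suc n))
    ≈⟨ *-assoc (qpoch a n) (factor a n) (qpochInf (a *ₚ X^ (suc n))) ⟩
  qpoch a n *ₚ (factor a n *ₚ qpochInf (a *ₚ X^ (suc n)))
    ≈⟨ *-cong (≈-refl {qpoch a n}) peel ⟨
  qpoch a n *ₚ qpochInf (a *ₚ X^ n)
    ≈⟨ qpoch-split z n ⟩
  qpochInf a ∎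
  where
  peel : qpochInf (a *ₚ X^ n) ≈ factor a n *ₚ qpochInf (a *ₚ X^ (suc n))
  peel = ≈-trans (qpochInf-shift (val-*ʳ {a} {X^ n} z))
    (*-cong (≈-refl {factor a n}) (qpochInf-cong (≈-trans (*-assoc a (X^ n) q) (*-cong (≈-refl {a}) (X^-suc n)))))

qpochInf-≡[]1 : ∀ {a K} → ConstFree a → val≥ a K → qpochInf a ≡[ K ] 1ₚ
qpochInf-≡[]1 {a} {K} z v = ≡[]-trans (qpochInf-≡[] z K) (finite K)
  where
  finite : ∀ n → qpoch a n ≡[ K ] 1ₚ
  finite zero    = ≡[]-refl
  finite (suc n) = ≡[]-trans (≡[]-*1 {qpoch a n} {factor a n} (factor-≡[]1 {a} n (val-*ʳ {a} {X^ n} v))) (finite n)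

Summable : (ℕ → PS) → Set
Summable t = ∀ m → val≥ (t m) m

ΣP-cong< : ∀ n {f g} → (∀ i → i < n → f i ≈ g i) → ΣP n f ≈ ΣP n g
ΣP-cong< n p = mk≈ λ k → sum-cong< n (λ i h → at (p i h) k)

ΣP-+ : ∀ n f g → ΣP n (λ i → f i +ₚ g i) ≈ ΣP n f +ₚ ΣP n g
ΣP-+ n f g = mk≈ λ k → sum-+ n (λ i → f i k) (λ i → g i k)

ΣP-*ˡ : ∀ n c f → c *ₚ ΣP n f ≈ ΣP n (λ i → c *ₚ f i)
ΣP-*ˡ zero c f = ≈-trans (*-cong (≈-refl {c}) (mk≈ λ k → sym (0ₚ-coeff k)))
                         (≈-trans (*-zeroʳ c) (mk≈ 0ₚ-coeff))
ΣP-*ˡ (suc n) c f = ≈-trans (*-distribˡ-+ c (ΣP n f) (f n)) (+-cong (ΣP-*ˡ n c f) (≈-refl {c *ₚ f n}))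

ΣP-shift : ∀ n f → ΣP (suc n) f ≈ f 0 +ₚ ΣP n (f ∘ suc)
ΣP-shift n f = mk≈ λ k → sum-shift n (λ i → f i k)

sumFrom0-≡[] : ∀ {t} → Summable t → ∀ K → sumFrom0 t ≡[ K ] ΣP K t
sumFrom0-≡[] {t} s K i i<K = sym (sum-pad≤ (suc i) K (λ n → t n i) i<K (λ n i<n → s n i i<n))

sumFrom0-cong : ∀ {t u} → (∀ m → t m ≈ u m) → sumFrom0 t ≈ sumFrom0 u
sumFrom0-cong p = mk≈ λ k → sum-cong (suc k) (λ n → at (p n) k)

sumFrom0-+ : ∀ t u → sumFrom0 (λ m → t m +ₚ u m) ≈ sumFrom0 t +ₚ sumFrom0 u
sumFrom0-+ t u = mk≈ λ k → sum-+ (suc k) (λ n → t n k) (λ n → u n k)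

sumFrom0-neg : ∀ t → sumFrom0 (λ m → negₚ (t m)) ≈ negₚ (sumFrom0 t)
sumFrom0-neg t = mk≈ λ k → sym (sum-neg (suc k) (λ n → t n k))

summable-*ˡ : ∀ c {t} → Summable t → Summable (λ m → c *ₚ t m)
summable-*ˡ c {t} s m = val-*ˡ {c} {t m} (s m)

-- Multiplication distributes over infinite sums (checked modulo every q^K).
sumFrom0-*ˡ : ∀ c {t} → Summable t → c *ₚ sumFrom0 t ≈ sumFrom0 (λ m → c *ₚ t m)
sumFrom0-*ˡ c {t} s = ≡[]-all λ K →
  ≡[]-trans (≡[]-* (≡[]-refl {c}) (sumFrom0-≡[] s K))
  (≡[]-trans (≈⇒≡[] (ΣP-*ˡ K c t)) (≡[]-sym (sumFrom0-≡[] (summable-*ˡ c s) K)))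

sumFrom0-shift : ∀ {t} → Summable t → sumFrom0 t ≈ t 0 +ₚ sumFrom0 (t ∘ suc)
sumFrom0-shift {t} s = mk≈ λ k → trans (sum-shift k (λ n → t n k))
  (cong (t 0 k +ℤ_) (sym (trans (cong (sumℤ k (λ n → t (suc n) k) +ℤ_) (s (suc k) k (ℕP.n<1+n k)))
                                 (ℤP.+-identityʳ _))))

ΣP-sumFrom0 : ∀ n (t : ℕ → ℕ → PS) → ΣP n (λ i → sumFrom0 (t i)) ≈ sumFrom0 (λ m → ΣP n (λ i → t i m))
ΣP-sumFrom0 n t = mk≈ λ k → sum-swap n (suc k) (λ i m → t i m k)

sumFrom0-finite : ∀ {t} N → Summable t → (∀ m → N < m → t m ≈ 0ₚ) → sumFrom0 t ≈ ΣP (suc N) t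
sumFrom0-finite {t} N s z = mk≈ λ k → trans (sym (sum-pad (suc k) (suc N) (λ n → t n k) (λ n h → s n k h)))
  (trans (cong (λ x → sumℤ x (λ n → t n k)) (ℕP.+-comm (suc k) (suc N)))
         (sum-pad (suc N) (suc k) (λ n → t n k) (λ n h → trans (at (z n h) k) (0ₚ-coeff k))))

sumFrom0-val : ∀ {t K} → (∀ m → val≥ (t m) K) → val≥ (sumFrom0 t) K
sumFrom0-val v i h = sum-zero (suc i) (λ n _ → v n i h)

-- (1 - w) Σ t = t 0 + Σ_m (t (m+1) - w t m): the form in which a
-- functional equation for a power series in z is read off term by term.
sumFrom0-difference : ∀ w {t} → Summable t →
  sumFrom0 t -ₚ w *ₚ sumFrom0 t ≈ t 0 +ₚ sumFrom0 (λ m → t (suc m) -ₚ w *ₚ t m)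
sumFrom0-difference w {t} s = begin
  sumFrom0 t -ₚ w *ₚ sumFrom0 t
    ≈⟨ +-cong (sumFrom0-shift s) (neg-cong (sumFrom0-*ˡ w s)) ⟩
  (t 0 +ₚ sumFrom0 (t ∘ suc)) -ₚ sumFrom0 (λ m → w *ₚ t m)
    ≈⟨ +-cong (≈-refl {t 0 +ₚ sumFrom0 (t ∘ suc)}) (sumFrom0-neg (λ m → w *ₚ t m)) ⟨
  (t 0 +ₚ sumFrom0 (t ∘ suc)) +ₚ sumFrom0 (λ m → negₚ (w *ₚ t m))
    ≈⟨ +-assoc (t 0) _ _ ⟩
  t 0 +ₚ (sumFrom0 (t ∘ suc) +ₚ sumFrom0 (λ m → negₚ (w *ₚ t m)))
    ≈⟨ +-cong (≈-refl {t 0}) (sumFrom0-+ (t ∘ suc) (λ m → negₚ (w *ₚ t m))) ⟨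
  t 0 +ₚ sumFrom0 (λ m → t (suc m) -ₚ w *ₚ t m) ∎

-- The q-binomial theorem
--   Σ_m (a;q)_m/(q;q)_m z^m · (z;q)_∞ = (az;q)_∞   at z = q^{n+1}.
-- Writing F n for the sum at z = q^{n+1}, the coefficient recurrence gives
-- (1 - z) F n = (1 - az) F (n+1); the defect H n = F n (z;q)_∞ - (az;q)_∞
-- then satisfies H n = (1 - az) H (n+1) and H n ≡ 0 mod q^{n+1}, so by
-- induction q^{n+1+d} divides H n for every d, i.e. H n = 0.

constFree-q : ConstFree q
constFree-q = constFree-X^ 0

factor-q : ∀ m → factor q m ≈ 1ₚ -ₚ X^ (suc m)
factor-q m = +-cong (≈-refl {1ₚ}) (neg-cong (X^-+ 1 m))

unit-qpoch-q : ∀ m → unit (qpoch q m)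
unit-qpoch-q m = unit-qpoch constFree-q m

X^-shift-past : ∀ i e j → X^ i *ₚ (e *ₚ X^ j) ≈ e *ₚ X^ (i +ℕ j)
X^-shift-past i e j = ≈-trans (solve 3 (λ x e y → x :* (e :* y) := e :* (x :* y)) ≈-refl (X^ i) e (X^ j))
                              (*-cong (≈-refl {e}) (X^-+ i j))

qpochInf-step : ∀ {b c} → ConstFree b → b *ₚ q ≈ c → qpochInf b ≈ (1ₚ -ₚ b) *ₚ qpochInf c
qpochInf-step {b} z bq≈c = ≈-trans (qpochInf-shift z) (*-cong (≈-refl {1ₚ -ₚ b}) (qpochInf-cong bq≈c))

module QBinomial (a : PS) where

  coeff : ℕ → PS
  coeff m = qpoch a m /ₚ qpoch q m

  coeff-recurrence : ∀ m → coeff (suc m) *ₚ (1ₚ -ₚ X^ (suc m)) ≈ coeff m *ₚ factor a m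
  coeff-recurrence m = ≈-trans (*-cong (≈-refl {coeff (suc m)}) (≈-sym (factor-q m)))
    (*-cancelʳ {b = qpoch q m} (unit-qpoch-q m) (≈-trans next (≈-sym this)))
    where
    next : (coeff (suc m) *ₚ factor q m) *ₚ qpoch q m ≈ qpoch a (suc m)
    next = ≈-trans (*-assoc (coeff (suc m)) (factor q m) (qpoch q m))
      (≈-trans (*-cong (≈-refl {coeff (suc m)}) (*-comm (factor q m) (qpoch q m)))
               (div-* {qpoch a (suc m)} {qpoch q (suc m)} (unit-qpoch-q (suc m))))
    this : (coeff m *ₚ factor a m) *ₚ qpoch q m ≈ qpoch a (suc m)
    this = ≈-trans (solve 3 (λ c f d → (c :* f) :* d := (c :* d) :* f) ≈-refl (coeff m) (factor a m) (qpoch q m))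
                   (*-cong (div-* {qpoch a m} {qpoch q m} (unit-qpoch-q m)) (≈-refl {factor a m}))

  term : ℕ → ℕ → PS
  term n m = coeff m *ₚ X^ (m *ℕ suc n)

  term-val : ∀ n m K → K ≤ m *ℕ suc n → val≥ (term n m) K
  term-val n m K h = val-*ˡ {coeff m} {X^ (m *ℕ suc n)} (val-mono h (val-X^ (m *ℕ suc n)))

  term-summable : ∀ n → Summable (term n)
  term-summable n m = term-val n m m (ℕP.m≤m*n m (suc n))

  F : ℕ → PS
  F n = sumFrom0 (term n)

  -- termwise form of (1 - z) F n = (1 - az) F (n+1), from coeff-recurrence
  term-difference : ∀ n m →
    term n (suc m) -ₚ X^ (suc n) *ₚ term n m ≈ term (suc n) (suc m) -ₚ (a *ₚ X^ (suc n)) *ₚ term (suc n) m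
  term-difference n m = begin
    E1 *ₚ Y -ₚ x *ₚ (E0 *ₚ X^ (m *ℕ suc n))
      ≈⟨ +-cong (≈-refl {E1 *ₚ Y}) (neg-cong (X^-shift-past (suc n) E0 (m *ℕ suc n))) ⟩
    E1 *ₚ Y -ₚ E0 *ₚ Y
      ≈⟨ solve 6 (λ E1 E0 Y Xs Xm a → E1 :* Y :- E0 :* Y
                   := E1 :* (Y :* Xs) :- a :* (E0 :* (Y :* Xm))
                      :+ Y :* (E1 :* (con (+ 1) :- Xs) :- E0 :* (con (+ 1) :- a :* Xm)))
                 ≈-refl E1 E0 Y (X^ (suc m)) (X^ m) a ⟩
    E1 *ₚ (Y *ₚ X^ (suc m)) -ₚ a *ₚ (E0 *ₚ (Y *ₚ X^ m))
      +ₚ Y *ₚ (E1 *ₚ (1ₚ -ₚ X^ (suc m)) -ₚ E0 *ₚ factor a m)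
      ≈⟨ +-cong (≈-refl {E1 *ₚ (Y *ₚ X^ (suc m)) -ₚ a *ₚ (E0 *ₚ (Y *ₚ X^ m))})
                (≈-trans (*-cong (≈-refl {Y}) (≈-trans (+-cong (coeff-recurrence m) (≈-refl {negₚ (E0 *ₚ factor a m)})) (+-inverseʳ (E0 *ₚ factor a m))))
                                (*-zeroʳ Y)) ⟩
    E1 *ₚ (Y *ₚ X^ (suc m)) -ₚ a *ₚ (E0 *ₚ (Y *ₚ X^ m)) +ₚ 0ₚ
      ≈⟨ +-identityʳ _ ⟩
    E1 *ₚ (Y *ₚ X^ (suc m)) -ₚ a *ₚ (E0 *ₚ (Y *ₚ X^ m))
      ≈⟨ +-cong leading (neg-cong trailing) ⟩
    E1 *ₚ X^ (suc m *ℕ suc (suc n)) -ₚ (a *ₚ x) *ₚ (E0 *ₚ X^ (m *ℕ suc (suc n))) ∎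
    where
    x  = X^ (suc n)
    E1 = coeff (suc m)
    E0 = coeff m
    Y  = X^ (suc m *ℕ suc n)
    exponent₁ : ∀ m n → suc m *ℕ suc n +ℕ suc m ≡ suc m *ℕ suc (suc n)
    exponent₁ = ℕSolver.solve-∀
    exponent₂ : ∀ m n → suc n +ℕ m *ℕ suc (suc n) ≡ suc m *ℕ suc n +ℕ m
    exponent₂ = ℕSolver.solve-∀
    leading : E1 *ₚ (Y *ₚ X^ (suc m)) ≈ E1 *ₚ X^ (suc m *ℕ suc (suc n))
    leading = *-cong (≈-refl {E1}) (≈-trans (X^-+ (suc m *ℕ suc n) (suc m)) (≡⇒≈ (cong X^ (exponent₁ m n))))
    trailing : a *ₚ (E0 *ₚ (Y *ₚ X^ m)) ≈ (a *ₚ x) *ₚ (E0 *ₚ X^ (m *ℕ suc (suc n)))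
    trailing = ≈-sym (≈-trans (*-assoc a x (E0 *ₚ X^ (m *ℕ suc (suc n)))) (*-cong (≈-refl {a}) (≈-trans (X^-shift-past (suc n) E0 (m *ℕ suc (suc n)))
      (*-cong (≈-refl {E0}) (≈-trans (≡⇒≈ (cong X^ (exponent₂ m n))) (≈-sym (X^-+ (suc m *ℕ suc n) m)))))))

  functional-equation : ∀ n → (1ₚ -ₚ X^ (suc n)) *ₚ F n ≈ (1ₚ -ₚ a *ₚ X^ (suc n)) *ₚ F (suc n)
  functional-equation n = begin
    (1ₚ -ₚ x) *ₚ F n
      ≈⟨ solve 2 (λ x F → (con (+ 1) :- x) :* F := F :- x :* F) ≈-refl x (F n) ⟩
    F n -ₚ x *ₚ F n
      ≈⟨ sumFrom0-difference x (term-summable n) ⟩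
    term n 0 +ₚ sumFrom0 (λ m → term n (suc m) -ₚ x *ₚ term n m)
      ≈⟨ +-cong (≈-refl {term n 0}) (sumFrom0-cong (term-difference n)) ⟩
    term (suc n) 0 +ₚ sumFrom0 (λ m → term (suc n) (suc m) -ₚ ax *ₚ term (suc n) m)
      ≈⟨ sumFrom0-difference ax (term-summable (suc n)) ⟨
    F (suc n) -ₚ ax *ₚ F (suc n)
      ≈⟨ solve 2 (λ x F → F :- x :* F := (con (+ 1) :- x) :* F) ≈-refl ax (F (suc n)) ⟩
    (1ₚ -ₚ ax) *ₚ F (suc n) ∎
    where
    x  = X^ (suc n)
    ax = a *ₚ X^ (suc n)

  -- F n ≡ 1 modulo q^{n+1}: only the m = 0 term contributes.
  F-≡[]1 : ∀ n → F n ≡[ suc n ] 1ₚ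
  F-≡[]1 n = ≡[]-trans (≈⇒≡[] (sumFrom0-shift (term-summable n)))
    (≡[]-trans (≡[]-+ (≈⇒≡[] first) (val⇒≡[]0 (sumFrom0-val rest)))
               (≈⇒≡[] (+-identityʳ 1ₚ)))
    where
    first : term n 0 ≈ 1ₚ
    first = ≈-trans (*-cong (inverseʳ {1ₚ} refl) X^-zero) (*-identityˡ 1ₚ)
    rest : ∀ m → val≥ (term n (suc m)) (suc n)
    rest m = term-val n (suc m) (suc n) (ℕP.m≤m+n (suc n) (m *ℕ suc n))

  H : ℕ → PS
  H n = F n *ₚ qpochInf (X^ (suc n)) -ₚ qpochInf (a *ₚ X^ (suc n))

  H-step : ∀ n → H n ≈ (1ₚ -ₚ a *ₚ X^ (suc n)) *ₚ H (suc n)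
  H-step n = begin
    F n *ₚ qpochInf x -ₚ qpochInf ax
      ≈⟨ +-cong (*-cong (≈-refl {F n}) P-step) (neg-cong A-step) ⟩
    F n *ₚ ((1ₚ -ₚ x) *ₚ P′) -ₚ (1ₚ -ₚ ax) *ₚ A′
      ≈⟨ solve 4 (λ F x P′ A′ → F :* ((con (+ 1) :- x) :* P′) :- A′ := ((con (+ 1) :- x) :* F) :* P′ :- A′)
                 ≈-refl (F n) x P′ ((1ₚ -ₚ ax) *ₚ A′) ⟩
    ((1ₚ -ₚ x) *ₚ F n) *ₚ P′ -ₚ (1ₚ -ₚ ax) *ₚ A′
      ≈⟨ +-cong (*-cong (functional-equation n) (≈-refl {P′})) (≈-refl {negₚ ((1ₚ -ₚ ax) *ₚ A′)}) ⟩
    ((1ₚ -ₚ ax) *ₚ F (suc n)) *ₚ P′ -ₚ (1ₚ -ₚ ax) *ₚ A′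
      ≈⟨ solve 4 (λ c F P′ A′ → (c :* F) :* P′ :- c :* A′ := c :* (F :* P′ :- A′)) ≈-refl (1ₚ -ₚ ax) (F (suc n)) P′ A′ ⟩
    (1ₚ -ₚ ax) *ₚ H (suc n) ∎
    where
    x  = X^ (suc n)
    ax = a *ₚ X^ (suc n)
    P′ = qpochInf (X^ (suc (suc n)))
    A′ = qpochInf (a *ₚ X^ (suc (suc n)))
    P-step : qpochInf x ≈ (1ₚ -ₚ x) *ₚ P′
    P-step = qpochInf-step (constFree-X^ n) (X^-suc (suc n))
    A-step : qpochInf ax ≈ (1ₚ -ₚ ax) *ₚ A′
    A-step = qpochInf-step (val-*ˡ {a} (constFree-X^ n))
      (≈-trans (*-assoc a x q) (*-cong (≈-refl {a}) (X^-suc (suc n))))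

  -- Modulo q^{n+1}, F n and both products are 1, so H n ≡ 1·1 - 1 = 0.
  H-≡[]0 : ∀ n → H n ≡[ suc n ] 0ₚ
  H-≡[]0 n = ≡[]-trans
    (≡[]-+ (≡[]-* (F-≡[]1 n) (qpochInf-≡[]1 (constFree-X^ n) (val-X^ (suc n))))
           (≡[]-neg (qpochInf-≡[]1 (val-*ˡ {a} (constFree-X^ n)) (val-*ˡ {a} (val-X^ (suc n))))))
    (≈⇒≡[] (solve 0 (con (+ 1) :* con (+ 1) :- con (+ 1) := con (+ 0)) ≈-refl))

  H-val : ∀ d n → val≥ (H n) (suc n +ℕ d)
  H-val zero    n = subst (val≥ (H n)) (sym (ℕP.+-identityʳ (suc n))) (≡[]0⇒val (H-≡[]0 n))
  H-val (suc d) n = subst (val≥ (H n)) (sym (ℕP.+-suc (suc n) d))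
    (val-cong (≈-sym (H-step n)) (val-*ˡ {1ₚ -ₚ a *ₚ X^ (suc n)} {H (suc n)} (H-val d (suc n))))

  -- H n has arbitrarily high valuation, hence vanishes.
  q-binomial : ∀ n → F n *ₚ qpochInf (X^ (suc n)) ≈ qpochInf (a *ₚ X^ (suc n))
  q-binomial n = mk≈ λ k → ℤP.i-j≡0⇒i≡j _ _ (H-val k n k (s≤s (ℕP.m≤n+m k n)))

-- The finite q-binomial theorem of Cauchy,
--   Σ_{n≤N} [N n] q^{n(n+1)/2} z^n = (-zq;q)_N,
-- by induction on N using the q-Pascal rule.

qbinom-≤ : ∀ {N n} → n ≤ N → qbinom N n ≡ qpoch q N /ₚ (qpoch q (N ∸ n) *ₚ qpoch q n)
qbinom-≤ {N} {n} n≤N with n ℕ.≤? N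
... | yes _   = refl
... | no  n≰N = ⊥-elim (n≰N n≤N)

qbinom-> : ∀ {N n} → N < n → qbinom N n ≡ 0ₚ
qbinom-> {N} {n} N<n with n ℕ.≤? N
... | yes n≤N = ⊥-elim (ℕP.<⇒≱ N<n n≤N)
... | no  _   = refl

unit-qpoch-q² : ∀ m n → unit (qpoch q m *ₚ qpoch q n)
unit-qpoch-q² m n = unit-* {qpoch q m} {qpoch q n} (unit-qpoch-q m) (unit-qpoch-q n)

qbinom-zero : ∀ N → qbinom N 0 ≈ 1ₚ
qbinom-zero N = ≈-trans (≡⇒≈ (qbinom-≤ {N} {0} z≤n))
  (≈-sym (div-unique {qpoch q N} {qpoch q N *ₚ 1ₚ} {1ₚ} (unit-qpoch-q² N 0)
    (≈-trans (*-identityˡ _) (*-identityʳ _))))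

qbinom-diag : ∀ N → qbinom N N ≈ 1ₚ
qbinom-diag N = ≈-trans (≡⇒≈ (qbinom-≤ {N} {N} ℕP.≤-refl))
  (≈-sym (div-unique {qpoch q N} {qpoch q (N ∸ N) *ₚ qpoch q N} {1ₚ} (unit-qpoch-q² (N ∸ N) N)
    (≈-trans (*-identityˡ _) (≈-trans (*-cong (≡⇒≈ (cong (qpoch q) (ℕP.n∸n≡0 N))) (≈-refl {qpoch q N}))
                                      (*-identityˡ _)))))

div-*-extra : ∀ c b f → unit b → (c /ₚ b) *ₚ (b *ₚ f) ≈ c *ₚ f
div-*-extra c b f u = ≈-trans (≈-sym (*-assoc (c /ₚ b) b f)) (*-cong (div-* {c} {b} u) (≈-refl {f}))

-- q-Pascal rule [N+1, j+1] = [N, j+1] + q^{N-j} [N, j], for j < N: multiply the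
-- right side by the denominator (q)_{N-j} (q)_{j+1} of the left side.
pascal-< : ∀ N j → j < N → qbinom (suc N) (suc j) ≈ qbinom N (suc j) +ₚ X^ (N ∸ j) *ₚ qbinom N j
pascal-< N j j<N = ≈-trans (≡⇒≈ (qbinom-≤ {suc N} {suc j} (s≤s (ℕP.<⇒≤ j<N))))
  (≈-sym (≈-trans (+-cong (≡⇒≈ (qbinom-≤ {N} {suc j} j<N))
                          (*-cong (≈-refl {X^ (N ∸ j)}) (≡⇒≈ (qbinom-≤ {N} {j} (ℕP.<⇒≤ j<N)))))
                  (div-unique {qpoch q (suc N)} {D} (unit-qpoch-q² (N ∸ j) (suc j)) cleared)))
  where
  k = N ∸ suc j
  N-j≡1+k : N ∸ j ≡ suc k
  N-j≡1+k = ℕP.+-∸-assoc 1 j<N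
  c  = qpoch q N
  D  = qpoch q (N ∸ j) *ₚ qpoch q (suc j)
  b₁ = c /ₚ (qpoch q k *ₚ qpoch q (suc j))
  b₀ = c /ₚ (qpoch q (N ∸ j) *ₚ qpoch q j)
  first : b₁ *ₚ D ≈ c *ₚ (1ₚ -ₚ X^ (suc k))
  first = begin
    b₁ *ₚ (qpoch q (N ∸ j) *ₚ qpoch q (suc j))
      ≈⟨ *-cong (≈-refl {b₁}) (*-cong (≡⇒≈ (cong (qpoch q) N-j≡1+k)) (≈-refl {qpoch q (suc j)})) ⟩
    b₁ *ₚ ((qpoch q k *ₚ factor q k) *ₚ qpoch q (suc j))
      ≈⟨ *-cong (≈-refl {b₁}) (solve 3 (λ a f b → (a :* f) :* b := (a :* b) :* f) ≈-refl (qpoch q k) (factor q k) (qpoch q (suc j))) ⟩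
    b₁ *ₚ ((qpoch q k *ₚ qpoch q (suc j)) *ₚ factor q k)
      ≈⟨ div-*-extra c (qpoch q k *ₚ qpoch q (suc j)) (factor q k) (unit-qpoch-q² k (suc j)) ⟩
    c *ₚ factor q k
      ≈⟨ *-cong (≈-refl {c}) (factor-q k) ⟩
    c *ₚ (1ₚ -ₚ X^ (suc k)) ∎
  second : b₀ *ₚ D ≈ c *ₚ (1ₚ -ₚ X^ (suc j))
  second = begin
    b₀ *ₚ (qpoch q (N ∸ j) *ₚ (qpoch q j *ₚ factor q j))
      ≈⟨ *-cong (≈-refl {b₀}) (≈-sym (*-assoc (qpoch q (N ∸ j)) (qpoch q j) (factor q j))) ⟩
    b₀ *ₚ ((qpoch q (N ∸ j) *ₚ qpoch q j) *ₚ factor q j)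
      ≈⟨ div-*-extra c (qpoch q (N ∸ j) *ₚ qpoch q j) (factor q j) (unit-qpoch-q² (N ∸ j) j) ⟩
    c *ₚ factor q j
      ≈⟨ *-cong (≈-refl {c}) (factor-q j) ⟩
    c *ₚ (1ₚ -ₚ X^ (suc j)) ∎
  exponent : suc k +ℕ suc j ≡ suc N
  exponent = trans (cong (_+ℕ suc j) (sym N-j≡1+k))
    (trans (ℕP.+-suc (N ∸ j) j) (cong suc (ℕP.m∸n+n≡m (ℕP.<⇒≤ j<N))))
  cleared : (b₁ +ₚ X^ (N ∸ j) *ₚ b₀) *ₚ D ≈ qpoch q (suc N)
  cleared = begin
    (b₁ +ₚ X^ (N ∸ j) *ₚ b₀) *ₚ D
      ≈⟨ solve 4 (λ b₁ x b₀ D → (b₁ :+ x :* b₀) :* D := b₁ :* D :+ x :* (b₀ :* D)) ≈-refl b₁ (X^ (N ∸ j)) b₀ D ⟩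
    b₁ *ₚ D +ₚ X^ (N ∸ j) *ₚ (b₀ *ₚ D)
      ≈⟨ +-cong first (*-cong (≡⇒≈ (cong X^ N-j≡1+k)) second) ⟩
    c *ₚ (1ₚ -ₚ X^ (suc k)) +ₚ X^ (suc k) *ₚ (c *ₚ (1ₚ -ₚ X^ (suc j)))
      ≈⟨ solve 3 (λ c x y → c :* (con (+ 1) :- x) :+ x :* (c :* (con (+ 1) :- y)) := c :* (con (+ 1) :- x :* y))
                 ≈-refl c (X^ (suc k)) (X^ (suc j)) ⟩
    c *ₚ (1ₚ -ₚ X^ (suc k) *ₚ X^ (suc j))
      ≈⟨ *-cong (≈-refl {c}) (+-cong (≈-refl {1ₚ}) (neg-cong (≈-trans (X^-+ (suc k) (suc j)) (≡⇒≈ (cong X^ exponent))))) ⟩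
    c *ₚ (1ₚ -ₚ X^ (suc N))
      ≈⟨ *-cong (≈-refl {c}) (factor-q N) ⟨
    qpoch q (suc N) ∎

pascal : ∀ N j → j ≤ N → qbinom (suc N) (suc j) ≈ qbinom N (suc j) +ₚ X^ (N ∸ j) *ₚ qbinom N j
pascal N j j≤N with ℕP.m≤n⇒m<n∨m≡n j≤N
... | inj₁ j<N  = pascal-< N j j<N
... | inj₂ refl = ≈-trans (qbinom-diag (suc j)) (≈-sym (begin
  qbinom j (suc j) +ₚ X^ (j ∸ j) *ₚ qbinom j j
    ≈⟨ +-cong (≡⇒≈ (qbinom-> {j} {suc j} ℕP.≤-refl)) (*-cong (≡⇒≈ (cong X^ (ℕP.n∸n≡0 j))) (qbinom-diag j)) ⟩
  0ₚ +ₚ X^ 0 *ₚ 1ₚ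
    ≈⟨ ≈-trans (+-identityˡ _) (≈-trans (*-identityʳ (X^ 0)) X^-zero) ⟩
  1ₚ ∎))

cauchy-term : PS → ℕ → ℕ → PS
cauchy-term z N n = qbinom N n *ₚ X^ (tri n) *ₚ powₚ z n

cauchy-term-zero : ∀ z N → cauchy-term z N 0 ≈ 1ₚ
cauchy-term-zero z N = ≈-trans (*-cong (*-cong (qbinom-zero N) X^-zero) (≈-refl {1ₚ}))
                               (≈-trans (*-identityʳ _) (*-identityʳ 1ₚ))

cauchy-term-beyond : ∀ z N → cauchy-term z N (suc N) ≈ 0ₚ
cauchy-term-beyond z N =
  ≈-trans (*-cong (*-cong (≡⇒≈ (qbinom-> {N} {suc N} ℕP.≤-refl)) (≈-refl {X^ (tri (suc N))})) (≈-refl {powₚ z (suc N)}))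
          (≈-trans (*-cong (*-zeroˡ (X^ (tri (suc N)))) (≈-refl {powₚ z (suc N)})) (*-zeroˡ (powₚ z (suc N))))

cauchy-term-pascal : ∀ z N j → j ≤ N →
  cauchy-term z (suc N) (suc j) ≈ cauchy-term z N (suc j) +ₚ cauchy-term z N j *ₚ (z *ₚ X^ (suc N))
cauchy-term-pascal z N j j≤N = begin
  qbinom (suc N) (suc j) *ₚ Xt *ₚ (zʲ *ₚ z)
    ≈⟨ *-cong (*-cong (pascal N j j≤N) (≈-refl {Xt})) (≈-refl {zʲ *ₚ z}) ⟩
  (b₁ +ₚ X^ (N ∸ j) *ₚ b₀) *ₚ Xt *ₚ (zʲ *ₚ z)
    ≈⟨ solve 6 (λ b₁ b₀ x Xt zʲ z → (b₁ :+ x :* b₀) :* Xt :* (zʲ :* z) := b₁ :* Xt :* (zʲ :* z) :+ b₀ :* (x :* Xt) :* zʲ :* z)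
               ≈-refl b₁ b₀ (X^ (N ∸ j)) Xt zʲ z ⟩
  b₁ *ₚ Xt *ₚ (zʲ *ₚ z) +ₚ b₀ *ₚ (X^ (N ∸ j) *ₚ Xt) *ₚ zʲ *ₚ z
    ≈⟨ +-cong (≈-refl {b₁ *ₚ Xt *ₚ (zʲ *ₚ z)}) (*-cong (*-cong (*-cong (≈-refl {b₀}) exponents) (≈-refl {zʲ})) (≈-refl {z})) ⟩
  b₁ *ₚ Xt *ₚ (zʲ *ₚ z) +ₚ b₀ *ₚ (X^ (tri j) *ₚ X^ (suc N)) *ₚ zʲ *ₚ z
    ≈⟨ solve 7 (λ b₁ Xt zʲ z b₀ Xtj XN → b₁ :* Xt :* (zʲ :* z) :+ b₀ :* (Xtj :* XN) :* zʲ :* z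
                                       := b₁ :* Xt :* (zʲ :* z) :+ b₀ :* Xtj :* zʲ :* (z :* XN))
               ≈-refl b₁ Xt zʲ z b₀ (X^ (tri j)) (X^ (suc N)) ⟩
  cauchy-term z N (suc j) +ₚ cauchy-term z N j *ₚ (z *ₚ X^ (suc N)) ∎
  where
  Xt = X^ (tri (suc j))
  zʲ = powₚ z j
  b₁ = qbinom N (suc j)
  b₀ = qbinom N j
  -- (N - j) + tri (j+1) = tri j + (N + 1)
  shuffle : ∀ d t j → d +ℕ (t +ℕ suc j) ≡ t +ℕ suc (d +ℕ j)
  shuffle = ℕSolver.solve-∀
  exponents : X^ (N ∸ j) *ₚ Xt ≈ X^ (tri j) *ₚ X^ (suc N)
  exponents = ≈-trans (X^-+ (N ∸ j) (tri (suc j)))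
    (≈-trans (≡⇒≈ (cong X^ (trans (shuffle (N ∸ j) (tri j) j) (cong (λ x → tri j +ℕ suc x) (ℕP.m∸n+n≡m j≤N)))))
             (≈-sym (X^-+ (tri j) (suc N))))

cauchy-binomial : ∀ N z → ΣP (suc N) (cauchy-term z N) ≈ qpoch (negₚ (z *ₚ q)) N
cauchy-binomial zero z = mk≈ λ k → trans (ℤP.+-identityˡ _) (at (cauchy-term-zero z 0) k)
cauchy-binomial (suc N) z = begin
  ΣP (suc (suc N)) (T (suc N))
    ≈⟨ ΣP-shift (suc N) (T (suc N)) ⟩
  T (suc N) 0 +ₚ ΣP (suc N) (λ j → T (suc N) (suc j))
    ≈⟨ +-cong (≈-trans (cauchy-term-zero z (suc N)) (≈-sym (cauchy-term-zero z N)))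
              (ΣP-cong< (suc N) (λ j j<1+N → cauchy-term-pascal z N j (ℕP.≤-pred j<1+N))) ⟩
  T N 0 +ₚ ΣP (suc N) (λ j → T N (suc j) +ₚ T N j *ₚ w)
    ≈⟨ +-cong (≈-refl {T N 0}) (ΣP-+ (suc N) (λ j → T N (suc j)) (λ j → T N j *ₚ w)) ⟩
  T N 0 +ₚ (ΣP (suc N) (λ j → T N (suc j)) +ₚ ΣP (suc N) (λ j → T N j *ₚ w))
    ≈⟨ +-assoc (T N 0) _ _ ⟨
  (T N 0 +ₚ ΣP (suc N) (λ j → T N (suc j))) +ₚ ΣP (suc N) (λ j → T N j *ₚ w)
    ≈⟨ +-cong reassemble factor-out ⟩
  S +ₚ w *ₚ S
    ≈⟨ solve 2 (λ S w → S :+ w :* S := S :* (con (+ 1) :+ w)) ≈-refl S w ⟩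
  S *ₚ (1ₚ +ₚ w)
    ≈⟨ *-cong (cauchy-binomial N z) new-factor ⟩
  qpoch (negₚ (z *ₚ q)) (suc N) ∎
  where
  T = cauchy-term z
  w = z *ₚ X^ (suc N)
  S = ΣP (suc N) (T N)
  -- the sum over j ≤ N+1 of T N j is S, since T N (N+1) = 0
  reassemble : T N 0 +ₚ ΣP (suc N) (λ j → T N (suc j)) ≈ S
  reassemble = ≈-trans (≈-sym (ΣP-shift (suc N) (T N)))
    (≈-trans (+-cong (≈-refl {S}) (cauchy-term-beyond z N)) (+-identityʳ S))
  factor-out : ΣP (suc N) (λ j → T N j *ₚ w) ≈ w *ₚ S
  factor-out = ≈-trans (ΣP-cong (suc N) (λ j → *-comm (T N j) w)) (≈-sym (ΣP-*ˡ (suc N) w (T N)))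
  new-factor : 1ₚ +ₚ w ≈ factor (negₚ (z *ₚ q)) N
  new-factor = ≈-sym (≈-trans (factor-neg (z *ₚ q) N)
    (+-cong (≈-refl {1ₚ}) (≈-trans (*-assoc z q (X^ N)) (*-cong (≈-refl {z}) (X^-+ 1 N)))))

open QBinomial (negₚ 1ₚ)

neg-one-* : ∀ x → negₚ 1ₚ *ₚ x ≈ negₚ x
neg-one-* = solve 1 (λ x → (:- con (+ 1)) :* x := :- x) ≈-refl

q-binomial-neg-one : ∀ n → F n *ₚ qpochInf (X^ (suc n)) ≈ qpochInf (negₚ (X^ (suc n)))
q-binomial-neg-one n = ≈-trans (q-binomial n) (qpochInf-cong (neg-one-* (X^ (suc n))))

qpoch-neg-one : ∀ m → qpoch (negₚ 1ₚ) (suc m) ≈ constP (+ 2) *ₚ qpoch (negₚ q) m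
qpoch-neg-one m = ≈-trans (qpoch-shift (negₚ 1ₚ) m)
  (*-cong (solve 0 (con (+ 1) :- (:- con (+ 1)) := con (+ 2)) ≈-refl)
          (qpoch-cong (neg-one-* q) m))

split-q : ∀ n → qpoch q n *ₚ qpochInf (X^ (suc n)) ≈ qpochInf q
split-q n = ≈-trans (*-cong (≈-refl {qpoch q n}) (qpochInf-cong (≈-sym (X^-+ 1 n)))) (qpoch-split constFree-q n)

neg-*ˡ : ∀ a b → negₚ a *ₚ b ≈ negₚ (a *ₚ b)
neg-*ˡ = solve 2 (λ a b → (:- a) :* b := :- (a :* b)) ≈-refl

split-neg-q : ∀ n → qpoch (negₚ q) n *ₚ qpochInf (negₚ (X^ (suc n))) ≈ qpochInf (negₚ q)
split-neg-q n = ≈-trans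
  (*-cong (≈-refl {qpoch (negₚ q) n}) (qpochInf-cong (≈-sym (≈-trans (neg-*ˡ q (X^ n)) (neg-cong (X^-+ 1 n))))))
  (qpoch-split (val-neg constFree-q) n)

split-neg-X^ : ∀ m N → qpoch (negₚ (X^ m *ₚ q)) N *ₚ qpochInf (negₚ (X^ (N +ℕ m +ℕ 1))) ≈ qpochInf (negₚ (X^ (suc m)))
split-neg-X^ m N = ≈-trans
  (*-cong (≈-refl {qpoch b N}) (qpochInf-cong (≈-sym bq^N)))
  (≈-trans (qpoch-split (val-neg (val-*ˡ {X^ m} constFree-q)) N) (qpochInf-cong (neg-cong (X^-suc m))))
  where
  b = negₚ (X^ m *ₚ q)
  exponent : ∀ m N → suc m +ℕ N ≡ N +ℕ m +ℕ 1
  exponent = ℕSolver.solve-∀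
  bq^N : b *ₚ X^ N ≈ negₚ (X^ (N +ℕ m +ℕ 1))
  bq^N = ≈-trans (neg-*ˡ (X^ m *ₚ q) (X^ N))
    (neg-cong (≈-trans (*-cong (X^-suc m) (≈-refl {X^ N})) (≈-trans (X^-+ (suc m) N) (≡⇒≈ (cong X^ (exponent m N))))))

cancel-inverse : ∀ x {u} → unit u → x *ₚ (invₚ u *ₚ u) ≈ x
cancel-inverse x {u} uu = ≈-trans (*-cong (≈-refl {x}) (inverseˡ {u} uu)) (*-identityʳ x)

cancel-inverses : ∀ x {u v} → unit u → unit v → x *ₚ ((invₚ u *ₚ u) *ₚ (invₚ v *ₚ v)) ≈ x
cancel-inverses x {u} {v} uu uv =
  ≈-trans (*-cong (≈-refl {x}) (≈-trans (*-cong (inverseˡ {u} uu) (inverseˡ {v} uv)) (*-identityˡ 1ₚ))) (*-identityʳ x)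

unit-neg-q∞ : ∀ m → unit (qpochInf (negₚ (X^ (suc m))))
unit-neg-q∞ m = unit-qpochInf (val-neg (constFree-X^ m))

pow-X^ : ∀ m n → powₚ (X^ m) n ≈ X^ (n *ℕ m)
pow-X^ m zero    = ≈-sym X^-zero
pow-X^ m (suc n) = ≈-trans (*-cong (pow-X^ m n) (≈-refl {X^ m}))
  (≈-trans (X^-+ (n *ℕ m) m) (≡⇒≈ (cong X^ (ℕP.+-comm (n *ℕ m) m))))

-- n ≤ n(n+1)/2, so q^n divides the n-th summand of σ.
tri-≥ : ∀ n → n ≤ tri n
tri-≥ zero    = z≤n
tri-≥ (suc n) = ℕP.m≤n+m (suc n) (tri n)

-- Expansion of σ(q,N): with K = (q;q)_∞/(-q;q)_∞,
--   (q;q)_n/(-q;q)_n = K (-q^{n+1};q)_∞/(q^{n+1};q)_∞ = K F n,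
-- and exchanging the sums over n and m (Cauchy's theorem at z = q^m) gives
--   σ(q,N) = K Σ_m (-1;q)_m/(q;q)_m q^m (-q^{m+1};q)_N.
module Expansion (N : ℕ) where

  K : PS
  K = qpochInf q /ₚ qpochInf (negₚ q)

  summand : ℕ → PS
  summand n = qbinom N n *ₚ qpoch q n *ₚ X^ (tri n) /ₚ qpoch (negₚ q) n

  summand-summable : Summable summand
  summand-summable n = val-*ʳ {qbinom N n *ₚ qpoch q n *ₚ X^ (tri n)} {invₚ (qpoch (negₚ q) n)}
    (val-*ˡ {qbinom N n *ₚ qpoch q n} {X^ (tri n)} (val-mono (tri-≥ n) (val-X^ (tri n))))

  summand-vanishes : ∀ n → N < n → summand n ≈ 0ₚ
  summand-vanishes n N<n = ≈-trans
    (*-cong (*-cong (*-cong (≡⇒≈ (qbinom-> {N} {n} N<n)) (≈-refl {qpoch q n})) (≈-refl {X^ (tri n)}))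
            (≈-refl {invₚ (qpoch (negₚ q) n)}))
    (solve 3 (λ a b c → con (+ 0) :* a :* b :* c := con (+ 0)) ≈-refl (qpoch q n) (X^ (tri n)) (invₚ (qpoch (negₚ q) n)))

  B : ℕ → PS
  B n = qbinom N n *ₚ X^ (tri n)

  -- Multiplying by (-q)_n: K [N n] q^{n(n+1)/2} F n (-q)_n
  --   = [N n] q^{n(n+1)/2} (q)_n · F n (q^{n+1})_∞ (-q)_n / (-q)_∞ = [N n] (q)_n q^{n(n+1)/2}.
  summand-via-F : ∀ n → summand n ≈ K *ₚ (B n *ₚ F n)
  summand-via-F n = ≈-sym (div-unique {qb *ₚ qn *ₚ Xt} {D} {K *ₚ (B n *ₚ F n)} (unit-qpoch (val-neg constFree-q) n) cleared)
    where
    qb  = qbinom N n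
    qn  = qpoch q n
    Xt  = X^ (tri n)
    D   = qpoch (negₚ q) n
    Pn  = qpochInf (X^ (suc n))
    Qn  = qpochInf (negₚ (X^ (suc n)))
    Q1  = qpochInf (negₚ q)
    iQ1 = invₚ Q1
    cleared : (K *ₚ (B n *ₚ F n)) *ₚ D ≈ qb *ₚ qn *ₚ Xt
    cleared = begin
      ((qpochInf q *ₚ iQ1) *ₚ ((qb *ₚ Xt) *ₚ F n)) *ₚ D
        ≈⟨ *-cong (*-cong (*-cong (split-q n) (≈-refl {iQ1})) (≈-refl {(qb *ₚ Xt) *ₚ F n})) (≈-refl {D}) ⟨
      (((qn *ₚ Pn) *ₚ iQ1) *ₚ ((qb *ₚ Xt) *ₚ F n)) *ₚ D
        ≈⟨ solve 7 (λ qn Pn iQ1 qb Xt F D → (((qn :* Pn) :* iQ1) :* ((qb :* Xt) :* F)) :* D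
                                          := (qb :* qn :* Xt) :* (((F :* Pn) :* D) :* iQ1))
                   ≈-refl qn Pn iQ1 qb Xt (F n) D ⟩
      (qb *ₚ qn *ₚ Xt) *ₚ (((F n *ₚ Pn) *ₚ D) *ₚ iQ1)
        ≈⟨ *-cong (≈-refl {qb *ₚ qn *ₚ Xt}) (*-cong (≈-trans (*-cong (q-binomial-neg-one n) (≈-refl {D}))
                                                              (≈-trans (*-comm Qn D) (split-neg-q n)))
                                                     (≈-refl {iQ1})) ⟩
      (qb *ₚ qn *ₚ Xt) *ₚ (Q1 *ₚ iQ1)
        ≈⟨ *-cong (≈-refl {qb *ₚ qn *ₚ Xt}) (inverseʳ {Q1} (unit-qpochInf (val-neg constFree-q))) ⟩
      (qb *ₚ qn *ₚ Xt) *ₚ 1ₚ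
        ≈⟨ *-identityʳ _ ⟩
      qb *ₚ qn *ₚ Xt ∎

  W : ℕ → PS
  W m = coeff m *ₚ (X^ m *ₚ qpoch (negₚ (X^ m *ₚ q)) N)

  -- Σ_n B n q^{m(n+1)} = q^m (-q^{m+1};q)_N by Cauchy's theorem at z = q^m.
  column : ∀ m → ΣP (suc N) (λ n → B n *ₚ term n m) ≈ W m
  column m = begin
    ΣP (suc N) (λ n → B n *ₚ term n m)
      ≈⟨ ΣP-cong (suc N) entry ⟩
    ΣP (suc N) (λ n → (coeff m *ₚ X^ m) *ₚ cauchy-term (X^ m) N n)
      ≈⟨ ΣP-*ˡ (suc N) (coeff m *ₚ X^ m) (cauchy-term (X^ m) N) ⟨
    (coeff m *ₚ X^ m) *ₚ ΣP (suc N) (cauchy-term (X^ m) N)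
      ≈⟨ *-cong (≈-refl {coeff m *ₚ X^ m}) (cauchy-binomial N (X^ m)) ⟩
    (coeff m *ₚ X^ m) *ₚ qpoch (negₚ (X^ m *ₚ q)) N
      ≈⟨ *-assoc (coeff m) (X^ m) (qpoch (negₚ (X^ m *ₚ q)) N) ⟩
    W m ∎
    where
    exponent : ∀ m n → m *ℕ suc n ≡ m +ℕ n *ℕ m
    exponent = ℕSolver.solve-∀
    entry : ∀ n → B n *ₚ term n m ≈ (coeff m *ₚ X^ m) *ₚ cauchy-term (X^ m) N n
    entry n = begin
      (qbinom N n *ₚ X^ (tri n)) *ₚ (coeff m *ₚ X^ (m *ℕ suc n))
        ≈⟨ *-cong (≈-refl {B n}) (*-cong (≈-refl {coeff m})
                  (≈-trans (≡⇒≈ (cong X^ (exponent m n))) (≈-sym (X^-+ m (n *ℕ m))))) ⟩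
      (qbinom N n *ₚ X^ (tri n)) *ₚ (coeff m *ₚ (X^ m *ₚ X^ (n *ℕ m)))
        ≈⟨ solve 5 (λ a b c d e → (a :* b) :* (c :* (d :* e)) := (c :* d) :* (a :* b :* e))
                   ≈-refl (qbinom N n) (X^ (tri n)) (coeff m) (X^ m) (X^ (n *ℕ m)) ⟩
      (coeff m *ₚ X^ m) *ₚ (qbinom N n *ₚ X^ (tri n) *ₚ X^ (n *ℕ m))
        ≈⟨ *-cong (≈-refl {coeff m *ₚ X^ m}) (*-cong (≈-refl {B n}) (pow-X^ m n)) ⟨
      (coeff m *ₚ X^ m) *ₚ cauchy-term (X^ m) N n ∎

  σ-expansion : σ N ≈ K *ₚ sumFrom0 W
  σ-expansion = begin
    sumFrom0 summand
      ≈⟨ sumFrom0-finite N summand-summable summand-vanishes ⟩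
    ΣP (suc N) summand
      ≈⟨ ΣP-cong (suc N) summand-via-F ⟩
    ΣP (suc N) (λ n → K *ₚ (B n *ₚ F n))
      ≈⟨ ΣP-*ˡ (suc N) K (λ n → B n *ₚ F n) ⟨
    K *ₚ ΣP (suc N) (λ n → B n *ₚ F n)
      ≈⟨ *-cong (≈-refl {K}) (ΣP-cong (suc N) (λ n → sumFrom0-*ˡ (B n) (term-summable n))) ⟩
    K *ₚ ΣP (suc N) (λ n → sumFrom0 (λ m → B n *ₚ term n m))
      ≈⟨ *-cong (≈-refl {K}) (ΣP-sumFrom0 (suc N) (λ n m → B n *ₚ term n m)) ⟩
    K *ₚ sumFrom0 (λ m → ΣP (suc N) (λ n → B n *ₚ term n m))
      ≈⟨ *-cong (≈-refl {K}) (sumFrom0-cong column) ⟩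
    K *ₚ sumFrom0 W ∎

  W-summable : Summable W
  W-summable m = val-*ˡ {coeff m} {X^ m *ₚ qpoch (negₚ (X^ m *ₚ q)) N}
    (val-*ʳ {X^ m} {qpoch (negₚ (X^ m *ₚ q)) N} (val-X^ m))

  R : ℕ → PS
  R n = (X^ n /ₚ (1ₚ +ₚ X^ n)) *ₚ (qpochInf (X^ (n +ℕ 1)) /ₚ qpochInf (negₚ (X^ (N +ℕ n +ℕ 1))))

  R-summable : Summable (R ∘ suc)
  R-summable m = val-*ʳ {X^ (suc m) /ₚ (1ₚ +ₚ X^ (suc m))} {qpochInf (X^ (suc m +ℕ 1)) /ₚ qpochInf (negₚ (X^ (N +ℕ suc m +ℕ 1)))}
    (val-*ʳ {X^ (suc m)} {invₚ (1ₚ +ₚ X^ (suc m))} (val-mono (ℕP.n≤1+n m) (val-X^ (suc m))))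

  KW-zero : K *ₚ W 0 ≈ qpochInf q /ₚ qpochInf (negₚ (X^ (N +ℕ 1)))
  KW-zero = ≈-trans (*-cong (≈-refl {K}) W-zero)
    (≈-trans (div-unique {qpochInf q} {qpochInf (negₚ (X^ (suc N)))} {K *ₚ qpoch (negₚ q) N} (unit-neg-q∞ N) cleared)
             (div-cong (≈-refl {qpochInf q}) (qpochInf-cong (neg-cong (≡⇒≈ (cong X^ (ℕP.+-comm 1 N)))))))
    where
    W-zero : W 0 ≈ qpoch (negₚ q) N
    W-zero = ≈-trans (*-cong (inverseʳ {1ₚ} refl)
                             (*-cong X^-zero (qpoch-cong (neg-cong (≈-trans (*-cong X^-zero (≈-refl {q})) (*-identityˡ q))) N)))
                     (≈-trans (*-identityˡ _) (*-identityˡ _))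
    cleared : (K *ₚ qpoch (negₚ q) N) *ₚ qpochInf (negₚ (X^ (suc N))) ≈ qpochInf q
    cleared = ≈-trans (*-assoc K (qpoch (negₚ q) N) (qpochInf (negₚ (X^ (suc N)))))
      (≈-trans (*-cong (≈-refl {K}) (split-neg-q N))
               (div-* {qpochInf q} {qpochInf (negₚ q)} (unit-qpochInf (val-neg constFree-q))))

  -- the terms m ≥ 1: using (-1;q)_m = 2 (-q;q)_{m-1}, both sides times (-q;q)_∞
  -- reduce to (q^{m+1};q)_∞ 2 (-q;q)_{m-1} q^m (-q^{m+1};q)_N.
  KW-suc : ∀ m → K *ₚ W (suc m) ≈ constP (+ 2) *ₚ R (suc m)
  KW-suc m = *-cancelʳ {K *ₚ W s} {two *ₚ R s} {Q1} unit-Q1 (≈-trans left (≈-sym right))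
    where
    s   = suc m
    two = constP (+ 2)
    Xs  = X^ s
    E   = qpoch (negₚ (Xs *ₚ q)) N
    qs  = qpoch q s
    Ps  = qpochInf (X^ (s +ℕ 1))
    Dm  = qpoch (negₚ q) m
    g   = 1ₚ +ₚ Xs
    QN  = qpochInf (negₚ (X^ (N +ℕ s +ℕ 1)))
    Q1  = qpochInf (negₚ q)
    core = Ps *ₚ ((two *ₚ Dm) *ₚ (Xs *ₚ E))
    unit-Q1 : unit Q1
    unit-Q1 = unit-neg-q∞ 0
    unit-g : unit g
    unit-g = cong (+ 1 +ℤ_) (X^-coeff-other s 0 (λ ()))
    unit-QN : unit QN
    unit-QN = unit-qpochInf (val-neg (val-mono (ℕP.m≤n+m 1 (N +ℕ s)) (val-X^ (N +ℕ s +ℕ 1))))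
    split-P1 : qpochInf q ≈ qs *ₚ Ps
    split-P1 = ≈-sym (≈-trans (*-cong (≈-refl {qs}) (qpochInf-cong (≡⇒≈ (cong X^ (ℕP.+-comm s 1))))) (split-q s))
    split-Q1 : Q1 ≈ (Dm *ₚ g) *ₚ (E *ₚ QN)
    split-Q1 = ≈-sym (≈-trans (*-cong (*-cong (≈-refl {Dm}) (≈-trans (+-cong (≈-refl {1ₚ}) (≈-sym (X^-+ 1 m))) (≈-sym (factor-neg q m))))
                                      (split-neg-X^ s N))
                              (split-neg-q s))
    left : (K *ₚ W s) *ₚ Q1 ≈ core
    left = begin
      ((qpochInf q *ₚ invₚ Q1) *ₚ Y) *ₚ Q1
        ≈⟨ solve 4 (λ p i y u → ((p :* i) :* y) :* u := (p :* y) :* (i :* u)) ≈-refl (qpochInf q) (invₚ Q1) Y Q1 ⟩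
      (qpochInf q *ₚ Y) *ₚ (invₚ Q1 *ₚ Q1)
        ≈⟨ cancel-inverse (qpochInf q *ₚ Y) unit-Q1 ⟩
      qpochInf q *ₚ ((qpoch (negₚ 1ₚ) s *ₚ invₚ qs) *ₚ (Xs *ₚ E))
        ≈⟨ *-cong split-P1 (≈-refl {Y}) ⟩
      (qs *ₚ Ps) *ₚ ((qpoch (negₚ 1ₚ) s *ₚ invₚ qs) *ₚ (Xs *ₚ E))
        ≈⟨ solve 5 (λ qs Ps c iqs y → (qs :* Ps) :* ((c :* iqs) :* y) := (Ps :* (c :* y)) :* (iqs :* qs))
                   ≈-refl qs Ps (qpoch (negₚ 1ₚ) s) (invₚ qs) (Xs *ₚ E) ⟩
      (Ps *ₚ (qpoch (negₚ 1ₚ) s *ₚ (Xs *ₚ E))) *ₚ (invₚ qs *ₚ qs)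
        ≈⟨ cancel-inverse (Ps *ₚ (qpoch (negₚ 1ₚ) s *ₚ (Xs *ₚ E))) (unit-qpoch-q s) ⟩
      Ps *ₚ (qpoch (negₚ 1ₚ) s *ₚ (Xs *ₚ E))
        ≈⟨ *-cong (≈-refl {Ps}) (*-cong (qpoch-neg-one m) (≈-refl {Xs *ₚ E})) ⟩
      core ∎
      where
      Y = W s
    right : (two *ₚ R s) *ₚ Q1 ≈ core
    right = begin
      (two *ₚ ((Xs *ₚ invₚ g) *ₚ (Ps *ₚ invₚ QN))) *ₚ Q1
        ≈⟨ *-cong (*-cong (≈-refl {two}) (interchange Xs (invₚ g) Ps (invₚ QN))) split-Q1 ⟩
      (two *ₚ ((Xs *ₚ Ps) *ₚ (invₚ g *ₚ invₚ QN))) *ₚ ((Dm *ₚ g) *ₚ (E *ₚ QN))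
        ≈⟨ *-cong (≈-refl {two *ₚ ((Xs *ₚ Ps) *ₚ (invₚ g *ₚ invₚ QN))}) (interchange Dm g E QN) ⟩
      (two *ₚ ((Xs *ₚ Ps) *ₚ (invₚ g *ₚ invₚ QN))) *ₚ ((Dm *ₚ E) *ₚ (g *ₚ QN))
        ≈⟨ solve 5 (λ t a i b u → (t :* (a :* i)) :* (b :* u) := ((t :* a) :* b) :* (i :* u))
                   ≈-refl two (Xs *ₚ Ps) (invₚ g *ₚ invₚ QN) (Dm *ₚ E) (g *ₚ QN) ⟩
      ((two *ₚ (Xs *ₚ Ps)) *ₚ (Dm *ₚ E)) *ₚ ((invₚ g *ₚ invₚ QN) *ₚ (g *ₚ QN))
        ≈⟨ *-cong (≈-refl {(two *ₚ (Xs *ₚ Ps)) *ₚ (Dm *ₚ E)}) (interchange (invₚ g) (invₚ QN) g QN) ⟩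
      ((two *ₚ (Xs *ₚ Ps)) *ₚ (Dm *ₚ E)) *ₚ ((invₚ g *ₚ g) *ₚ (invₚ QN *ₚ QN))
        ≈⟨ cancel-inverses ((two *ₚ (Xs *ₚ Ps)) *ₚ (Dm *ₚ E)) {g} {QN} unit-g unit-QN ⟩
      (two *ₚ (Xs *ₚ Ps)) *ₚ (Dm *ₚ E)
        ≈⟨ solve 5 (λ t x p d e → (t :* (x :* p)) :* (d :* e) := p :* ((t :* d) :* (x :* e))) ≈-refl two Xs Ps Dm E ⟩
      core ∎

  σ-identity : σ N ≈ qpochInf q /ₚ qpochInf (negₚ (X^ (N +ℕ 1))) +ₚ constP (+ 2) *ₚ sumFrom1 R
  σ-identity = begin
    σ N
      ≈⟨ σ-expansion ⟩
    K *ₚ sumFrom0 W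
      ≈⟨ sumFrom0-*ˡ K W-summable ⟩
    sumFrom0 (λ m → K *ₚ W m)
      ≈⟨ sumFrom0-shift (summable-*ˡ K W-summable) ⟩
    K *ₚ W 0 +ₚ sumFrom0 (λ m → K *ₚ W (suc m))
      ≈⟨ +-cong KW-zero (sumFrom0-cong KW-suc) ⟩
    qpochInf q /ₚ qpochInf (negₚ (X^ (N +ℕ 1))) +ₚ sumFrom0 (λ m → constP (+ 2) *ₚ R (suc m))
      ≈⟨ +-cong (≈-refl {qpochInf q /ₚ qpochInf (negₚ (X^ (N +ℕ 1)))}) (sumFrom0-*ˡ (constP (+ 2)) R-summable) ⟨
    qpochInf q /ₚ qpochInf (negₚ (X^ (N +ℕ 1))) +ₚ constP (+ 2) *ₚ sumFrom1 R ∎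

corollary1p3 : (N : ℕ) → 0 < N → (k : ℕ) →
    σ N k ≡
      (qpochInf q /ₚ qpochInf (negₚ (X^ (N +ℕ 1)))
        +ₚ constP (+ 2) *ₚ sumFrom1 (λ n →
             (X^ n /ₚ (1ₚ +ₚ X^ n))
               *ₚ (qpochInf (X^ (n +ℕ 1)) /ₚ qpochInf (negₚ (X^ (N +ℕ n +ℕ 1)))))) k
corollary1p3 N _ k = at (Expansion.σ-identity N) k
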